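{- Let $r$ and $n$ be positive integers with $r+2\le n\le 2r+1$, and let $m=\frac{nr}{2}$ (an integer). Consider all graphs of order $n$, size $m$ and maximum degree at most $r$ (equivalently, all $r$-regular graphs on $n$ vertices). Every such graph $G$ maximizing the number of triangles is the complement of an $(n-r-1)$-regular graph on $n$ vertices that minimizes the number of triangles among all $(n-r-1)$-regular graphs on $n$ vertices. In particular, if $n$ is even, or if $n$ is odd and $n\le r+1+2\lfloor r/3\rfloor$, then the maximum number of triangles equals $\binom{n}{3}-\frac n2\, r(n-1-r)$.
   Context: Graphs are finite and simple; the complement $\overline G$ of $G$ has the same vertex set and $uv\in E(\overline G)$ iff $u\ne v$ and $uv\notin E(G)$. -}

module Defs where

open import Data.Nat using (ℕ; zero; suc; _+_; _*_; _≤_; _<ᵇ_)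
open import Data.Bool using (Bool; true; false; if_then_else_; _∧_; not)
open import Data.Fin using (Fin; toℕ)
import Data.Fin as F
open import Data.Product using (_×_)
open import Relation.Binary.PropositionalEquality using (_≡_; _≢_)

record Graph (n : ℕ) : Set where
  field
    adj : Fin n → Fin n → Bool
    adj-sym : ∀ i j → adj i j ≡ adj j i
    adj-irr : ∀ i → adj i i ≡ false
open Graph public

sumF : ∀ {n} → (Fin n → ℕ) → ℕ
sumF {zero} f = 0
sumF {suc n} f = f F.zero + sumF (λ i → f (F.suc i))

countF : ∀ {n} → (Fin n → Bool) → ℕ
countF p = sumF (λ i → if p i then 1 else 0)

_<F_ : ∀ {n} → Fin n → Fin n → Bool
i <F j = toℕ i <ᵇ toℕ j

degree : ∀ {n} → Graph n → Fin n → ℕ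
degree G i = countF (adj G i)

size : ∀ {n} → Graph n → ℕ
size G = sumF λ i → countF λ j → (i <F j) ∧ adj G i j

triangles : ∀ {n} → Graph n → ℕ
triangles G = sumF λ i → sumF λ j → countF λ k →
  (i <F j) ∧ (j <F k) ∧ adj G i j ∧ adj G j k ∧ adj G i k

MaxDegreeAtMost : ∀ {n} → Graph n → ℕ → Set
MaxDegreeAtMost G r = ∀ i → degree G i ≤ r

Regular : ∀ {n} → Graph n → ℕ → Set
Regular G d = ∀ i → degree G i ≡ d

IsComplementOf : ∀ {n} → Graph n → Graph n → Set
IsComplementOf G H = ∀ i j → i ≢ j → adj G i j ≡ not (adj H i j)

InClass : ∀ {n} → ℕ → ℕ → Graph n → Set
InClass m r G = size G ≡ m × MaxDegreeAtMost G r

MaxTriangles : ∀ {n} → ℕ → ℕ → Graph n → Set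
MaxTriangles {n} m r G = InClass m r G × (∀ (G' : Graph n) → InClass m r G' → triangles G' ≤ triangles G)

MinTrianglesRegular : ∀ {n} → ℕ → Graph n → Set
MinTrianglesRegular {n} d H = Regular H d × (∀ (H' : Graph n) → Regular H' d → triangles H ≤ triangles H')

-- Since 2m = nr, the handshake lemma forces every graph in the class to be r-regular,
-- and its complement is then d-regular with d = n - r - 1.  Goodman's identity
--   Σ_v deg_G(v) · deg_H(v) + 2 t(G) + 2 t(H) = 2 (n choose 3)      (H the complement of G)
-- reads n r d + 2 t(G) + 2 t(H) = 2 (n choose 3) for such pairs, so t(G) + t(H) is constant:
-- maximising t(G) is the same as minimising t(H), which gives the first claim.  For the second
-- claim it suffices to exhibit a triangle-free d-regular graph on n vertices; its complement
-- attains the stated count.  For even n = 2h a bipartite circulant works (d ≤ h).  For odd n,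
-- 2m = nr makes d = 2K even and the hypothesis gives 5K < n: for 6K < n the circulant on ℤ/n
-- with distances in [K, 2K) is triangle-free, and for n ≤ 6K a blow-up of the 5-cycle is used.

module Submission where

open import Defs
open import Data.Nat using (ℕ; zero; suc; _+_; _*_; _∸_; _≤_; _<_; _/_; _%_; _<ᵇ_; _≡ᵇ_; z≤n; s≤s; NonZero; ≢-nonZero; >-nonZero)
open import Data.Nat.Properties
open import Data.Nat.Combinatorics using (_C_; nC1≡n; nCk+nC[k+1]≡[n+1]C[k+1])
open import Data.Nat.DivMod using ([m+n]%n≡m%n; m<n⇒m%n≡m; m≡m%n+[m/n]*n; m/n*n≤m)
open import Data.Nat.Tactic.RingSolver using (solve-∀)
open import Data.Bool using (Bool; true; false; if_then_else_; _∧_; _∨_; not)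
open import Data.Bool.Properties using (∧-assoc; ∧-comm; ∧-zeroʳ; ∧-identityʳ; ∨-comm; not-involutive)
  renaming (_≟_ to _≟ᴮ_)
open import Data.Fin using (Fin; toℕ) renaming (zero to fzero; suc to fsuc)
open import Data.Fin.Properties using (toℕ-injective; toℕ<n; all?) renaming (_≟_ to _≟ᶠ_)
open import Data.Product using (_×_; Σ; _,_; proj₁; proj₂)
open import Data.Sum using (_⊎_; inj₁; inj₂)
open import Data.Empty using (⊥; ⊥-elim)
open import Function using (_∘_)
open import Relation.Nullary using (yes; no)
open import Relation.Nullary.Decidable using (toWitness)
open import Relation.Binary.PropositionalEquality

χ : Bool → ℕ
χ b = if b then 1 else 0

χ-∧ : ∀ a b → χ (a ∧ b) ≡ χ a * χ b
χ-∧ true  b = sym (+-identityʳ (χ b))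
χ-∧ false b = refl

sumF-cong : ∀ {n} {f g : Fin n → ℕ} → (∀ i → f i ≡ g i) → sumF f ≡ sumF g
sumF-cong {zero}  e = refl
sumF-cong {suc n} e = cong₂ _+_ (e fzero) (sumF-cong (λ i → e (fsuc i)))

sumF-+ : ∀ {n} (f g : Fin n → ℕ) → sumF (λ i → f i + g i) ≡ sumF f + sumF g
sumF-+ {zero}  f g = refl
sumF-+ {suc n} f g =
  trans (cong (f fzero + g fzero +_) (sumF-+ (λ i → f (fsuc i)) (λ i → g (fsuc i))))
        (+-+-interchange (f fzero) (g fzero) _ _)
  where
  +-+-interchange : ∀ a b c d → (a + b) + (c + d) ≡ (a + c) + (b + d)
  +-+-interchange = solve-∀

sumF-const : ∀ {n} c → sumF {n} (λ _ → c) ≡ n * c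
sumF-const {zero}  c = refl
sumF-const {suc n} c = cong (c +_) (sumF-const {n} c)

sumF-zero : ∀ {n} → sumF {n} (λ _ → 0) ≡ 0
sumF-zero {n} = trans (sumF-const {n} 0) (*-zeroʳ n)

sumF-*ˡ : ∀ {n} c (f : Fin n → ℕ) → sumF (λ i → c * f i) ≡ c * sumF f
sumF-*ˡ {zero}  c f = sym (*-zeroʳ c)
sumF-*ˡ {suc n} c f =
  trans (cong (c * f fzero +_) (sumF-*ˡ c (λ i → f (fsuc i))))
        (sym (*-distribˡ-+ c (f fzero) _))

sumF-comm : ∀ {m n} (f : Fin m → Fin n → ℕ) →
  sumF (λ i → sumF (λ j → f i j)) ≡ sumF (λ j → sumF (λ i → f i j))
sumF-comm {zero}  {n} f = sym (sumF-zero {n})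
sumF-comm {suc m}     f =
  trans (cong (sumF (f fzero) +_) (sumF-comm (λ i → f (fsuc i))))
        (sym (sumF-+ (f fzero) _))

sumF-product : ∀ {m n} (f : Fin m → ℕ) (g : Fin n → ℕ) →
  sumF f * sumF g ≡ sumF (λ i → sumF (λ j → f i * g j))
sumF-product f g = begin
  sumF f * sumF g                       ≡⟨ *-comm (sumF f) (sumF g) ⟩
  sumF g * sumF f                       ≡⟨ sym (sumF-*ˡ (sumF g) f) ⟩
  sumF (λ i → sumF g * f i)             ≡⟨ sumF-cong (λ i → *-comm (sumF g) (f i)) ⟩
  sumF (λ i → f i * sumF g)             ≡⟨ sumF-cong (λ i → sym (sumF-*ˡ (f i) g)) ⟩
  sumF (λ i → sumF (λ j → f i * g j))   ∎
  where open ≡-Reasoning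

Σ3 : ∀ {n} → (Fin n → Fin n → Fin n → ℕ) → ℕ
Σ3 F = sumF λ i → sumF λ j → sumF λ k → F i j k

Σ3-cong : ∀ {n} {F G : Fin n → Fin n → Fin n → ℕ} → (∀ i j k → F i j k ≡ G i j k) → Σ3 F ≡ Σ3 G
Σ3-cong e = sumF-cong (λ i → sumF-cong (λ j → sumF-cong (e i j)))

Σ3-+ : ∀ {n} (F G : Fin n → Fin n → Fin n → ℕ) →
  Σ3 (λ i j k → F i j k + G i j k) ≡ Σ3 F + Σ3 G
Σ3-+ F G = trans
  (sumF-cong (λ i → trans (sumF-cong (λ j → sumF-+ (F i j) (G i j)))
                          (sumF-+ (λ j → sumF (F i j)) (λ j → sumF (G i j)))))
  (sumF-+ (λ i → sumF (λ j → sumF (F i j))) (λ i → sumF (λ j → sumF (G i j))))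

Σ3-*ˡ : ∀ {n} c (F : Fin n → Fin n → Fin n → ℕ) → Σ3 (λ i j k → c * F i j k) ≡ c * Σ3 F
Σ3-*ˡ c F = trans
  (sumF-cong (λ i → trans (sumF-cong (λ j → sumF-*ˡ c (F i j))) (sumF-*ˡ c (λ j → sumF (F i j)))))
  (sumF-*ˡ c (λ i → sumF (λ j → sumF (F i j))))

Σ3-linear : ∀ {n} (F G H : Fin n → Fin n → Fin n → ℕ) →
  Σ3 (λ i j k → F i j k + 2 * G i j k + 2 * H i j k) ≡ Σ3 F + 2 * Σ3 G + 2 * Σ3 H
Σ3-linear F G H = begin
  Σ3 (λ i j k → F i j k + 2 * G i j k + 2 * H i j k)
    ≡⟨ Σ3-+ (λ i j k → F i j k + 2 * G i j k) (λ i j k → 2 * H i j k) ⟩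
  Σ3 (λ i j k → F i j k + 2 * G i j k) + Σ3 (λ i j k → 2 * H i j k)
    ≡⟨ cong₂ _+_ (Σ3-+ F (λ i j k → 2 * G i j k)) (Σ3-*ˡ 2 H) ⟩
  Σ3 F + Σ3 (λ i j k → 2 * G i j k) + 2 * Σ3 H
    ≡⟨ cong (λ z → Σ3 F + z + 2 * Σ3 H) (Σ3-*ˡ 2 G) ⟩
  Σ3 F + 2 * Σ3 G + 2 * Σ3 H ∎
  where open ≡-Reasoning

Σ3-swap₁₂ : ∀ {n} (F : Fin n → Fin n → Fin n → ℕ) → Σ3 (λ i j k → F j i k) ≡ Σ3 F
Σ3-swap₁₂ F = sumF-comm (λ i j → sumF (F j i))

Σ3-swap₂₃ : ∀ {n} (F : Fin n → Fin n → Fin n → ℕ) → Σ3 (λ i j k → F i k j) ≡ Σ3 F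
Σ3-swap₂₃ F = sumF-cong (λ i → sumF-comm (λ j k → F i k j))

sym6 : {A : Set} → (A → A → A → ℕ) → A → A → A → ℕ
sym6 F i j k = F i j k + F i k j + F j i k + F j k i + F k i j + F k j i

Σ3-sym6 : ∀ {n} (F : Fin n → Fin n → Fin n → ℕ) → Σ3 (sym6 F) ≡ 6 * Σ3 F
Σ3-sym6 F = begin
  Σ3 (sym6 F)
    ≡⟨ Σ3-+ (λ i j k → F i j k + F i k j + F j i k + F j k i + F k i j) F₆ ⟩
  Σ3 (λ i j k → F i j k + F i k j + F j i k + F j k i + F k i j) + Σ3 F₆
    ≡⟨ cong (_+ Σ3 F₆) (Σ3-+ (λ i j k → F i j k + F i k j + F j i k + F j k i) F₅) ⟩
  Σ3 (λ i j k → F i j k + F i k j + F j i k + F j k i) + Σ3 F₅ + Σ3 F₆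
    ≡⟨ cong (λ z → z + Σ3 F₅ + Σ3 F₆) (Σ3-+ (λ i j k → F i j k + F i k j + F j i k) F₄) ⟩
  Σ3 (λ i j k → F i j k + F i k j + F j i k) + Σ3 F₄ + Σ3 F₅ + Σ3 F₆
    ≡⟨ cong (λ z → z + Σ3 F₄ + Σ3 F₅ + Σ3 F₆) (Σ3-+ (λ i j k → F i j k + F i k j) F₃) ⟩
  Σ3 (λ i j k → F i j k + F i k j) + Σ3 F₃ + Σ3 F₄ + Σ3 F₅ + Σ3 F₆
    ≡⟨ cong (λ z → z + Σ3 F₃ + Σ3 F₄ + Σ3 F₅ + Σ3 F₆) (Σ3-+ F F₂) ⟩
  Σ3 F + Σ3 F₂ + Σ3 F₃ + Σ3 F₄ + Σ3 F₅ + Σ3 F₆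
    ≡⟨ cong₂ _+_ (cong₂ _+_ (cong₂ _+_ (cong₂ _+_ (cong (Σ3 F +_) e₂) e₃) e₄) e₅) e₆ ⟩
  Σ3 F + Σ3 F + Σ3 F + Σ3 F + Σ3 F + Σ3 F
    ≡⟨ sixfold (Σ3 F) ⟩
  6 * Σ3 F ∎
  where
  open ≡-Reasoning
  F₂ F₃ F₄ F₅ F₆ : _ → _ → _ → ℕ
  F₂ i j k = F i k j
  F₃ i j k = F j i k
  F₄ i j k = F j k i
  F₅ i j k = F k i j
  F₆ i j k = F k j i
  e₂ : Σ3 F₂ ≡ Σ3 F
  e₂ = Σ3-swap₂₃ F
  e₃ : Σ3 F₃ ≡ Σ3 F
  e₃ = Σ3-swap₁₂ F
  e₄ : Σ3 F₄ ≡ Σ3 F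
  e₄ = trans (Σ3-swap₁₂ F₂) e₂
  e₅ : Σ3 F₅ ≡ Σ3 F
  e₅ = trans (Σ3-swap₂₃ F₃) e₃
  e₆ : Σ3 F₆ ≡ Σ3 F
  e₆ = trans (Σ3-swap₁₂ F₅) e₅
  sixfold : ∀ x → x + x + x + x + x + x ≡ 6 * x
  sixfold = solve-∀

sym6-*ʳ : {A : Set} (F G : A → A → A → ℕ) →
  (∀ i j k → G j i k ≡ G i j k) → (∀ i j k → G i k j ≡ G i j k) →
  ∀ i j k → sym6 (λ a b c → F a b c * G a b c) i j k ≡ sym6 F i j k * G i j k
sym6-*ʳ F G swap₁₂ swap₂₃ i j k =
  factor (F i j k) (F i k j) (F j i k) (F j k i) (F k i j) (F k j i) g₂ g₃ g₄ g₅ g₆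
  where
  g₂ : G i k j ≡ G i j k
  g₂ = swap₂₃ i j k
  g₃ : G j i k ≡ G i j k
  g₃ = swap₁₂ i j k
  g₄ : G j k i ≡ G i j k
  g₄ = trans (swap₂₃ j i k) g₃
  g₅ : G k i j ≡ G i j k
  g₅ = trans (swap₁₂ i k j) g₂
  g₆ : G k j i ≡ G i j k
  g₆ = trans (swap₁₂ j k i) g₄
  distrib : ∀ a b c d e f g →
    a * g + b * g + c * g + d * g + e * g + f * g ≡ (a + b + c + d + e + f) * g
  distrib = solve-∀
  factor : ∀ a b c d e f {g h₂ h₃ h₄ h₅ h₆} → h₂ ≡ g → h₃ ≡ g → h₄ ≡ g → h₅ ≡ g → h₆ ≡ g →
    a * g + b * h₂ + c * h₃ + d * h₄ + e * h₅ + f * h₆ ≡ (a + b + c + d + e + f) * g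
  factor a b c d e f {g} refl refl refl refl refl = distrib a b c d e f g

-- Goodman's identity

precedes : ℕ → ℕ → ℕ → ℕ
precedes a b c = χ ((a <ᵇ b) ∧ (b <ᵇ c))

ordered : ∀ {n} → Fin n → Fin n → Fin n → ℕ
ordered i j k = χ (i <F j ∧ j <F k)

<ᵇ-irrefl : ∀ a → (a <ᵇ a) ≡ false
<ᵇ-irrefl zero    = refl
<ᵇ-irrefl (suc a) = <ᵇ-irrefl a

χ-<ᵇ-connex : ∀ a b → a ≢ b → χ (a <ᵇ b) + χ (b <ᵇ a) ≡ 1
χ-<ᵇ-connex zero    zero    a≢b = ⊥-elim (a≢b refl)
χ-<ᵇ-connex zero    (suc b) _   = refl
χ-<ᵇ-connex (suc a) zero    _   = refl
χ-<ᵇ-connex (suc a) (suc b) a≢b = χ-<ᵇ-connex a b (λ e → a≢b (cong suc e))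

sym6-precedes-distinct : ∀ a b c → a ≢ b → b ≢ c → a ≢ c → sym6 precedes a b c ≡ 1
sym6-precedes-distinct zero    zero    c       ab bc ac = ⊥-elim (ab refl)
sym6-precedes-distinct zero    (suc b) zero    ab bc ac = ⊥-elim (ac refl)
sym6-precedes-distinct (suc a) zero    zero    ab bc ac = ⊥-elim (bc refl)
sym6-precedes-distinct zero    (suc b) (suc c) ab bc ac
  rewrite ∧-zeroʳ (b <ᵇ c) | ∧-zeroʳ (c <ᵇ b) =
  trans (drop-zeros (χ (b <ᵇ c) + χ (c <ᵇ b))) (χ-<ᵇ-connex b c (λ e → bc (cong suc e)))
  where
  drop-zeros : ∀ x → x + 0 + 0 + 0 + 0 ≡ x
  drop-zeros = solve-∀
sym6-precedes-distinct (suc a) zero    (suc c) ab bc ac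
  rewrite ∧-zeroʳ (a <ᵇ c) | ∧-zeroʳ (c <ᵇ a) =
  trans (drop-zeros (χ (a <ᵇ c)) (χ (c <ᵇ a))) (χ-<ᵇ-connex a c (λ e → ac (cong suc e)))
  where
  drop-zeros : ∀ x y → 0 + 0 + x + y + 0 + 0 ≡ x + y
  drop-zeros = solve-∀
sym6-precedes-distinct (suc a) (suc b) zero    ab bc ac
  rewrite ∧-zeroʳ (a <ᵇ b) | ∧-zeroʳ (b <ᵇ a) =
  trans (drop-zeros (χ (a <ᵇ b)) (χ (b <ᵇ a))) (χ-<ᵇ-connex a b (λ e → ab (cong suc e)))
  where
  drop-zeros : ∀ x y → 0 + 0 + 0 + 0 + x + y ≡ x + y
  drop-zeros = solve-∀
sym6-precedes-distinct (suc a) (suc b) (suc c) ab bc ac =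
  sym6-precedes-distinct a b c (λ e → ab (cong suc e)) (λ e → bc (cong suc e)) (λ e → ac (cong suc e))

sym6-precedes-aac : ∀ a c → sym6 precedes a a c ≡ 0
sym6-precedes-aac zero    zero    = refl
sym6-precedes-aac zero    (suc c) = refl
sym6-precedes-aac (suc a) zero    rewrite <ᵇ-irrefl a = refl
sym6-precedes-aac (suc a) (suc c) = sym6-precedes-aac a c

sym6-precedes-abb : ∀ a b → sym6 precedes a b b ≡ 0
sym6-precedes-abb zero    zero    = refl
sym6-precedes-abb zero    (suc b) rewrite <ᵇ-irrefl b = refl
sym6-precedes-abb (suc a) zero    = refl
sym6-precedes-abb (suc a) (suc b) = sym6-precedes-abb a b

sym6-precedes-aba : ∀ a b → sym6 precedes a b a ≡ 0
sym6-precedes-aba zero    zero    = refl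
sym6-precedes-aba zero    (suc b) = refl
sym6-precedes-aba (suc a) zero    rewrite <ᵇ-irrefl a = refl
sym6-precedes-aba (suc a) (suc b) = sym6-precedes-aba a b

Σ-increasing-pairs : ∀ n → sumF {n} (λ j → sumF {n} (λ k → χ (j <F k))) ≡ n C 2
Σ-increasing-pairs zero    = refl
Σ-increasing-pairs (suc n) = begin
  sumF {n} (λ _ → 1) + sumF {n} (λ j → sumF {n} (λ k → χ (j <F k)))
    ≡⟨ cong₂ _+_ (trans (sumF-const {n} 1) (*-identityʳ n)) (Σ-increasing-pairs n) ⟩
  n + n C 2
    ≡⟨ cong (_+ n C 2) (sym (nC1≡n n)) ⟩
  n C 1 + n C 2
    ≡⟨ nCk+nC[k+1]≡[n+1]C[k+1] n 1 ⟩
  suc n C 2 ∎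
  where open ≡-Reasoning

Σ3-ordered : ∀ n → Σ3 {n} ordered ≡ n C 3
Σ3-ordered zero    = refl
Σ3-ordered (suc n) = begin
  sumF {suc n} (λ j → sumF {suc n} (λ k → ordered fzero j k))
    + sumF {n} (λ i → sumF {suc n} (λ j → sumF {suc n} (λ k → ordered (fsuc i) j k)))
    ≡⟨ cong₂ _+_ smallest-is-zero rest ⟩
  sumF {n} (λ j → sumF {n} (λ k → χ (j <F k))) + Σ3 {n} ordered
    ≡⟨ cong₂ _+_ (Σ-increasing-pairs n) (Σ3-ordered n) ⟩
  n C 2 + n C 3
    ≡⟨ nCk+nC[k+1]≡[n+1]C[k+1] n 2 ⟩
  suc n C 3 ∎
  where
  open ≡-Reasoning
  -- triples starting at vertex 0 are pairs in the remaining vertices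
  smallest-is-zero : sumF {suc n} (λ j → sumF {suc n} (λ k → ordered fzero j k))
                   ≡ sumF {n} (λ j → sumF {n} (λ k → χ (j <F k)))
  smallest-is-zero = cong (_+ sumF {n} (λ j → sumF {n} (λ k → χ (j <F k)))) (sumF-zero {suc n})
  -- no triple has vertex 0 in the middle or last position
  rest : sumF {n} (λ i → sumF {suc n} (λ j → sumF {suc n} (λ k → ordered (fsuc i) j k)))
       ≡ Σ3 {n} ordered
  rest = sumF-cong (λ i → trans
    (cong (_+ sumF {n} (λ j → χ ((i <F j) ∧ false) + sumF (ordered i j))) (sumF-zero {suc n}))
    (sumF-cong (λ j → cong (λ b → χ b + sumF (ordered i j)) (∧-zeroʳ (i <F j)))))

isTriangle : ∀ {n} → Graph n → Fin n → Fin n → Fin n → Bool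
isTriangle X i j k = adj X i j ∧ adj X j k ∧ adj X i k

isTriangle-swap₁₂ : ∀ {n} (X : Graph n) i j k → isTriangle X j i k ≡ isTriangle X i j k
isTriangle-swap₁₂ X i j k rewrite adj-sym X j i = cong (adj X i j ∧_) (∧-comm (adj X i k) (adj X j k))

isTriangle-swap₂₃ : ∀ {n} (X : Graph n) i j k → isTriangle X i k j ≡ isTriangle X i j k
isTriangle-swap₂₃ X i j k rewrite adj-sym X k j = ∧-reverse (adj X i j) (adj X j k) (adj X i k)
  where
  ∧-reverse : ∀ a b c → c ∧ b ∧ a ≡ a ∧ b ∧ c
  ∧-reverse a b c = trans (∧-comm c (b ∧ a)) (trans (cong (_∧ c) (∧-comm b a)) (∧-assoc a b c))

triangles-Σ3 : ∀ {n} (X : Graph n) →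
  triangles X ≡ Σ3 (λ i j k → ordered i j k * χ (isTriangle X i j k))
triangles-Σ3 X = Σ3-cong λ i j k →
  trans (cong χ (sym (∧-assoc (i <F j) (j <F k) (isTriangle X i j k)))) (χ-∧ (i <F j ∧ j <F k) (isTriangle X i j k))

sym6-triangle : ∀ {n} (X : Graph n) i j k →
  sym6 (λ a b c → ordered a b c * χ (isTriangle X a b c)) i j k
  ≡ sym6 ordered i j k * χ (isTriangle X i j k)
sym6-triangle X = sym6-*ʳ ordered (λ a b c → χ (isTriangle X a b c))
  (λ a b c → cong χ (isTriangle-swap₁₂ X a b c)) (λ a b c → cong χ (isTriangle-swap₂₃ X a b c))

mixed : ∀ {n} → Graph n → Graph n → Fin n → Fin n → Fin n → ℕ
mixed G H v u w = χ (adj G v u) * χ (adj H v w)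

Σ3-mixed : ∀ {n} (G H : Graph n) → Σ3 (mixed G H) ≡ sumF (λ v → degree G v * degree H v)
Σ3-mixed G H = sumF-cong λ v → sym (sumF-product (λ u → χ (adj G v u)) (λ w → χ (adj H v w)))

complement-disjoint : ∀ {n} (G H : Graph n) → IsComplementOf G H →
  ∀ v w → χ (adj G v w) * χ (adj H v w) ≡ 0
complement-disjoint G H c v w with v ≟ᶠ w
... | yes refl rewrite adj-irr G v = refl
... | no v≢w rewrite c v w v≢w = χ-not (adj H v w)
  where
  χ-not : ∀ b → χ (not b) * χ b ≡ 0
  χ-not true  = refl
  χ-not false = refl

mixed-iik : ∀ {n} (G H : Graph n) → IsComplementOf G H → ∀ i k → sym6 (mixed G H) i i k ≡ 0
mixed-iik G H c i k
  rewrite adj-irr G i | adj-irr H i | complement-disjoint G H c k i | *-zeroʳ (χ (adj G i k)) = refl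

mixed-ijj : ∀ {n} (G H : Graph n) → IsComplementOf G H → ∀ i j → sym6 (mixed G H) i j j ≡ 0
mixed-ijj G H c i j
  rewrite adj-irr G j | adj-irr H j | complement-disjoint G H c i j | *-zeroʳ (χ (adj G j i)) = refl

mixed-iji : ∀ {n} (G H : Graph n) → IsComplementOf G H → ∀ i j → sym6 (mixed G H) i j i ≡ 0
mixed-iji G H c i j
  rewrite adj-irr G i | adj-irr H i | complement-disjoint G H c j i | *-zeroʳ (χ (adj G i j)) = refl

-- On three distinct vertices: either the triple is monochromatic (a triangle of G or of H)
-- or exactly two of its vertices are centres of a mixed cherry, each in two ways.
goodman-triple : ∀ {n} (G H : Graph n) → IsComplementOf G H → ∀ i j k → i ≢ j → j ≢ k → i ≢ k →
  sym6 (mixed G H) i j k + 2 * χ (isTriangle G i j k) + 2 * χ (isTriangle H i j k) ≡ 2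
goodman-triple G H c i j k i≢j j≢k i≢k
  rewrite c i j i≢j | c i k i≢k | c j k j≢k
        | c j i (i≢j ∘ sym) | c k i (i≢k ∘ sym) | c k j (j≢k ∘ sym)
        | adj-sym H j i | adj-sym H k i | adj-sym H k j
  = two-colourings (adj H i j) (adj H j k) (adj H i k)
  where
  two-colourings : ∀ x y z →
    χ (not x) * χ z + χ (not z) * χ x + χ (not x) * χ y + χ (not y) * χ x
    + χ (not z) * χ y + χ (not y) * χ z + 2 * χ (not x ∧ not y ∧ not z) + 2 * χ (x ∧ y ∧ z) ≡ 2
  two-colourings true  true  true  = refl
  two-colourings true  true  false = refl
  two-colourings true  false true  = refl
  two-colourings true  false false = refl
  two-colourings false true  true  = refl
  two-colourings false true  false = refl
  two-colourings false false true  = refl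
  two-colourings false false false = refl

≢-toℕ : ∀ {n} {a b : Fin n} → a ≢ b → toℕ a ≢ toℕ b
≢-toℕ a≢b e = a≢b (toℕ-injective e)

-- The two shapes of the pointwise identity below: on a repeated triple every term vanishes,
-- on three distinct vertices exactly one of the six orderings is increasing.
collapse : ∀ g S a b → (g ≡ 0 × S ≡ 0) ⊎ (S ≡ 1 × g + 2 * a + 2 * b ≡ 2) →
  g + 2 * (S * a) + 2 * (S * b) ≡ 2 * S
collapse g S a b (inj₁ (refl , refl)) = refl
collapse g S a b (inj₂ (refl , e)) =
  trans (cong₂ (λ x y → g + 2 * x + 2 * y) (*-identityˡ a) (*-identityˡ b)) e

goodman-pointwise : ∀ {n} (G H : Graph n) → IsComplementOf G H → ∀ i j k →
  sym6 (mixed G H) i j k + 2 * (sym6 ordered i j k * χ (isTriangle G i j k))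
    + 2 * (sym6 ordered i j k * χ (isTriangle H i j k)) ≡ 2 * sym6 ordered i j k
goodman-pointwise G H c i j k =
  collapse (sym6 (mixed G H) i j k) (sym6 ordered i j k) (χ (isTriangle G i j k)) (χ (isTriangle H i j k))
           triple-kind
  where
  triple-kind : (sym6 (mixed G H) i j k ≡ 0 × sym6 ordered i j k ≡ 0)
              ⊎ (sym6 ordered i j k ≡ 1 × sym6 (mixed G H) i j k + 2 * χ (isTriangle G i j k)
                                             + 2 * χ (isTriangle H i j k) ≡ 2)
  triple-kind with i ≟ᶠ j | j ≟ᶠ k | i ≟ᶠ k
  ... | yes refl | _        | _        = inj₁ (mixed-iik G H c i k , sym6-precedes-aac (toℕ i) (toℕ k))
  ... | no _     | yes refl | _        = inj₁ (mixed-ijj G H c i j , sym6-precedes-abb (toℕ i) (toℕ j))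
  ... | no _     | no _     | yes refl = inj₁ (mixed-iji G H c i j , sym6-precedes-aba (toℕ i) (toℕ j))
  ... | no i≢j   | no j≢k   | no i≢k   = inj₂
    ( sym6-precedes-distinct (toℕ i) (toℕ j) (toℕ k) (≢-toℕ i≢j) (≢-toℕ j≢k) (≢-toℕ i≢k)
    , goodman-triple G H c i j k i≢j j≢k i≢k )

-- Both sides are multiplied by 6 and written as symmetrised sums over ordered triples.
goodman : ∀ {n} (G H : Graph n) → IsComplementOf G H →
  sumF (λ v → degree G v * degree H v) + 2 * triangles G + 2 * triangles H ≡ 2 * (n C 3)
goodman {n} G H c = *-cancelˡ-≡ _ _ 6 (begin
  6 * (D + 2 * triangles G + 2 * triangles H)
    ≡⟨ regroup D (triangles G) (triangles H) ⟩
  6 * D + 2 * (6 * triangles G) + 2 * (6 * triangles H)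
    ≡⟨ cong₂ (λ x y → 6 * x + 2 * (6 * y) + 2 * (6 * triangles H)) (sym (Σ3-mixed G H)) (triangles-Σ3 G) ⟩
  6 * Σ3 (mixed G H) + 2 * (6 * Σ3 (tri G)) + 2 * (6 * triangles H)
    ≡⟨ cong (λ y → 6 * Σ3 (mixed G H) + 2 * (6 * Σ3 (tri G)) + 2 * (6 * y)) (triangles-Σ3 H) ⟩
  6 * Σ3 (mixed G H) + 2 * (6 * Σ3 (tri G)) + 2 * (6 * Σ3 (tri H))
    ≡⟨ sym (cong₂ _+_ (cong₂ (λ x y → x + 2 * y) (Σ3-sym6 (mixed G H)) (Σ3-sym6 (tri G)))
                      (cong (2 *_) (Σ3-sym6 (tri H)))) ⟩
  Σ3 (sym6 (mixed G H)) + 2 * Σ3 (sym6 (tri G)) + 2 * Σ3 (sym6 (tri H))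
    ≡⟨ sym (Σ3-linear (sym6 (mixed G H)) (sym6 (tri G)) (sym6 (tri H))) ⟩
  Σ3 (λ i j k → sym6 (mixed G H) i j k + 2 * sym6 (tri G) i j k + 2 * sym6 (tri H) i j k)
    ≡⟨ Σ3-cong (λ i j k → trans
         (cong₂ (λ x y → sym6 (mixed G H) i j k + 2 * x + 2 * y) (sym6-triangle G i j k) (sym6-triangle H i j k))
         (goodman-pointwise G H c i j k)) ⟩
  Σ3 (λ i j k → 2 * sym6 (ordered {n}) i j k)
    ≡⟨ Σ3-*ˡ 2 (sym6 (ordered {n})) ⟩
  2 * Σ3 (sym6 (ordered {n}))
    ≡⟨ cong (2 *_) (trans (Σ3-sym6 (ordered {n})) (cong (6 *_) (Σ3-ordered n))) ⟩
  2 * (6 * (n C 3))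
    ≡⟨ *-comm-middle (n C 3) ⟩
  6 * (2 * (n C 3)) ∎)
  where
  open ≡-Reasoning
  D : ℕ
  D = sumF (λ v → degree G v * degree H v)
  tri : Graph n → Fin n → Fin n → Fin n → ℕ
  tri X i j k = ordered i j k * χ (isTriangle X i j k)
  regroup : ∀ a b c → 6 * (a + 2 * b + 2 * c) ≡ 6 * a + 2 * (6 * b) + 2 * (6 * c)
  regroup = solve-∀
  *-comm-middle : ∀ x → 2 * (6 * x) ≡ 6 * (2 * x)
  *-comm-middle = solve-∀

distinct : ∀ {n} → Fin n → Fin n → Bool
distinct i j = i <F j ∨ j <F i

distinct-sym : ∀ {n} (i j : Fin n) → distinct i j ≡ distinct j i
distinct-sym i j = ∨-comm (i <F j) (j <F i)

distinct-irrefl : ∀ {n} (i : Fin n) → distinct i i ≡ false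
distinct-irrefl i rewrite <ᵇ-irrefl (toℕ i) = refl

distinct-true : ∀ {n} {i j : Fin n} → i ≢ j → distinct i j ≡ true
distinct-true {i = i} {j} i≢j = at-least-one (i <F j) (j <F i) (χ-<ᵇ-connex _ _ (≢-toℕ i≢j))
  where
  at-least-one : ∀ a b → χ a + χ b ≡ 1 → a ∨ b ≡ true
  at-least-one true  b     _ = refl
  at-least-one false true  _ = refl

count-equal : ∀ {n} (v : Fin n) → countF (λ u → not (distinct v u)) ≡ 1
count-equal {suc n} fzero    = cong suc (sumF-zero {n})
count-equal {suc n} (fsuc v) = count-equal v

edge-split : ∀ {n} (G : Graph n) i j →
  χ (adj G i j) ≡ χ ((i <F j) ∧ adj G i j) + χ ((j <F i) ∧ adj G j i)
edge-split G i j with i ≟ᶠ j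
... | yes refl rewrite adj-irr G i | ∧-zeroʳ (i <F i) = refl
... | no i≢j rewrite adj-sym G j i = split (i <F j) (j <F i) (adj G i j) (χ-<ᵇ-connex _ _ (≢-toℕ i≢j))
  where
  split : ∀ a b x → χ a + χ b ≡ 1 → χ x ≡ χ (a ∧ x) + χ (b ∧ x)
  split true  false x _ = sym (+-identityʳ (χ x))
  split false true  x _ = refl

handshake : ∀ {n} (G : Graph n) → sumF (degree G) ≡ 2 * size G
handshake G = begin
  sumF (λ i → sumF (λ j → χ (adj G i j)))
    ≡⟨ sumF-cong (λ i → trans (sumF-cong (edge-split G i)) (sumF-+ (forward i) (backward i))) ⟩
  sumF (λ i → sumF (forward i) + sumF (backward i))
    ≡⟨ sumF-+ (λ i → sumF (forward i)) (λ i → sumF (backward i)) ⟩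
  size G + sumF (λ i → sumF (backward i))
    ≡⟨ cong (size G +_) (sumF-comm backward) ⟩
  size G + size G
    ≡⟨ cong (size G +_) (sym (+-identityʳ (size G))) ⟩
  2 * size G ∎
  where
  open ≡-Reasoning
  forward backward : _ → _ → ℕ
  forward  i j = χ ((i <F j) ∧ adj G i j)
  backward i j = χ ((j <F i) ∧ adj G j i)

+-tight : ∀ {a b c d} → a + b ≡ c + d → a ≤ c → b ≤ d → a ≡ c × b ≡ d
+-tight {a} {b} {c} {d} e a≤c b≤d = a≡c , +-cancelˡ-≡ c b d (trans (cong (_+ b) (sym a≡c)) e)
  where
  a≡c : a ≡ c
  a≡c = ≤-antisym a≤c (+-cancelʳ-≤ d c a (≤-trans (≤-reflexive (sym e)) (+-monoʳ-≤ a b≤d)))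

sumF-≤ : ∀ {n} (f : Fin n → ℕ) r → (∀ i → f i ≤ r) → sumF f ≤ n * r
sumF-≤ {zero}  f r f≤r = z≤n
sumF-≤ {suc n} f r f≤r = +-mono-≤ (f≤r fzero) (sumF-≤ (f ∘ fsuc) r (f≤r ∘ fsuc))

sumF-≡-bound : ∀ {n} (f : Fin n → ℕ) r → (∀ i → f i ≤ r) → sumF f ≡ n * r → ∀ i → f i ≡ r
sumF-≡-bound {suc n} f r f≤r e i = pick i
  where
  tight : f fzero ≡ r × sumF (f ∘ fsuc) ≡ n * r
  tight = +-tight e (f≤r fzero) (sumF-≤ (f ∘ fsuc) r (f≤r ∘ fsuc))
  pick : ∀ i → f i ≡ r
  pick fzero    = proj₁ tight
  pick (fsuc i) = sumF-≡-bound (f ∘ fsuc) r (f≤r ∘ fsuc) (proj₂ tight) i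

inClass⇒regular : ∀ {n} m r (G : Graph n) → 2 * m ≡ n * r → InClass m r G → Regular G r
inClass⇒regular m r G 2m≡nr (size≡m , Δ≤r) =
  sumF-≡-bound (degree G) r Δ≤r (trans (handshake G) (trans (cong (2 *_) size≡m) 2m≡nr))

regular⇒inClass : ∀ {n} m r (G : Graph n) → 2 * m ≡ n * r → Regular G r → InClass m r G
regular⇒inClass {n} m r G 2m≡nr reg = size≡m , λ i → ≤-reflexive (reg i)
  where
  size≡m : size G ≡ m
  size≡m = *-cancelˡ-≡ (size G) m 2
    (trans (sym (handshake G)) (trans (trans (sumF-cong reg) (sumF-const {n} r)) (sym 2m≡nr)))

complement : ∀ {n} → Graph n → Graph n
complement G = record
  { adj     = λ i j → distinct i j ∧ not (adj G i j)
  ; adj-sym = λ i j → cong₂ (λ x y → x ∧ not y) (distinct-sym i j) (adj-sym G i j)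
  ; adj-irr = λ i → cong (_∧ not (adj G i i)) (distinct-irrefl i)
  }

complement-isComplement : ∀ {n} (G : Graph n) → IsComplementOf (complement G) G
complement-isComplement G i j i≢j rewrite distinct-true i≢j = refl

isComplement-complement : ∀ {n} (G : Graph n) → IsComplementOf G (complement G)
isComplement-complement G i j i≢j rewrite distinct-true i≢j = sym (not-involutive (adj G i j))

-- Every other vertex is a neighbour of v in exactly one of G and its complement.
complement-degree : ∀ {n} (G : Graph n) v → degree (complement G) v + degree G v + 1 ≡ n
complement-degree {n} G v = begin
  degree (complement G) v + degree G v + 1
    ≡⟨ cong₂ _+_ (sym (sumF-+ (λ u → χ (adj (complement G) v u)) (λ u → χ (adj G v u))))
                 (sym (count-equal v)) ⟩
  sumF (λ u → χ (adj (complement G) v u) + χ (adj G v u)) + countF (λ u → not (distinct v u))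
    ≡⟨ sym (sumF-+ _ (λ u → χ (not (distinct v u)))) ⟩
  sumF (λ u → χ (adj (complement G) v u) + χ (adj G v u) + χ (not (distinct v u)))
    ≡⟨ sumF-cong one-of-three ⟩
  sumF {n} (λ _ → 1)
    ≡⟨ trans (sumF-const {n} 1) (*-identityʳ n) ⟩
  n ∎
  where
  open ≡-Reasoning
  one-of-three : ∀ u → χ (adj (complement G) v u) + χ (adj G v u) + χ (not (distinct v u)) ≡ 1
  one-of-three u with v ≟ᶠ u
  ... | yes refl rewrite distinct-irrefl v | adj-irr G v = refl
  ... | no v≢u rewrite distinct-true v≢u with adj G v u
  ...   | true  = refl
  ...   | false = refl

complement-regular : ∀ {n} (G : Graph n) r d → r + d + 1 ≡ n → Regular G r → Regular (complement G) d
complement-regular G r d r+d+1≡n reg v = +-cancelʳ-≡ r _ d (+-cancelʳ-≡ 1 _ _ (begin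
  degree (complement G) v + r + 1           ≡⟨ cong (λ x → degree (complement G) v + x + 1) (sym (reg v)) ⟩
  degree (complement G) v + degree G v + 1  ≡⟨ complement-degree G v ⟩
  _                                         ≡⟨ sym r+d+1≡n ⟩
  r + d + 1                                 ≡⟨ cong (_+ 1) (+-comm r d) ⟩
  d + r + 1                                 ∎))
  where open ≡-Reasoning

complement-degree-sum : ∀ {n} r → r + 1 ≤ n → r + (n ∸ r ∸ 1) + 1 ≡ n
complement-degree-sum {n} r r+1≤n = begin
  r + (n ∸ r ∸ 1) + 1   ≡⟨ cong (λ x → r + x + 1) (∸-+-assoc n r 1) ⟩
  r + (n ∸ (r + 1)) + 1 ≡⟨ regroup r (n ∸ (r + 1)) ⟩
  r + 1 + (n ∸ (r + 1)) ≡⟨ m+[n∸m]≡n r+1≤n ⟩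
  n                     ∎
  where
  open ≡-Reasoning
  regroup : ∀ a b → a + b + 1 ≡ a + 1 + b
  regroup = solve-∀

goodman-regular : ∀ {n} (G H : Graph n) r d → IsComplementOf G H → Regular G r → Regular H d →
  n * (r * d) + 2 * triangles G + 2 * triangles H ≡ 2 * (n C 3)
goodman-regular {n} G H r d c regG regH = trans
  (cong (λ x → x + 2 * triangles G + 2 * triangles H) (sym degree-products))
  (goodman G H c)
  where
  degree-products : sumF (λ v → degree G v * degree H v) ≡ n * (r * d)
  degree-products = trans (sumF-cong (λ v → cong₂ _*_ (regG v) (regH v))) (sumF-const {n} (r * d))

-- The extremal reduction

TriangleFreeRegular : ℕ → ℕ → Set
TriangleFreeRegular n d = Σ (Graph n) λ H → Regular H d × triangles H ≡ 0

triangle-sum-invariant : ∀ {n} r d (G H G′ H′ : Graph n) →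
  IsComplementOf G H → Regular G r → Regular H d →
  IsComplementOf G′ H′ → Regular G′ r → Regular H′ d →
  triangles G + triangles H ≡ triangles G′ + triangles H′
triangle-sum-invariant {n} r d G H G′ H′ c rG rH c′ rG′ rH′ =
  *-cancelˡ-≡ _ _ 2 (+-cancelˡ-≡ (n * (r * d)) _ _ (begin
    n * (r * d) + 2 * (triangles G + triangles H)
      ≡⟨ regroup (n * (r * d)) (triangles G) (triangles H) ⟩
    n * (r * d) + 2 * triangles G + 2 * triangles H
      ≡⟨ trans (goodman-regular G H r d c rG rH) (sym (goodman-regular G′ H′ r d c′ rG′ rH′)) ⟩
    n * (r * d) + 2 * triangles G′ + 2 * triangles H′
      ≡⟨ sym (regroup (n * (r * d)) (triangles G′) (triangles H′)) ⟩
    n * (r * d) + 2 * (triangles G′ + triangles H′) ∎))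
  where
  open ≡-Reasoning
  regroup : ∀ k x y → k + 2 * (x + y) ≡ k + 2 * x + 2 * y
  regroup = solve-∀

∸-swap : ∀ n a b → n ∸ a ∸ b ≡ n ∸ b ∸ a
∸-swap n a b = begin
  n ∸ a ∸ b    ≡⟨ ∸-+-assoc n a b ⟩
  n ∸ (a + b)  ≡⟨ cong (n ∸_) (+-comm a b) ⟩
  n ∸ (b + a)  ≡⟨ sym (∸-+-assoc n b a) ⟩
  n ∸ b ∸ a    ∎
  where open ≡-Reasoning

exchange : ∀ {a b a′ b′} → a + b ≡ a′ + b′ → a′ ≤ a → b ≤ b′
exchange {a} {b} {a′} {b′} e a′≤a = +-cancelˡ-≤ a′ b b′ (≤-trans (+-monoˡ-≤ b a′≤a) (≤-reflexive e))

maximum⇒complement-minimum : ∀ {n} m r → r + 1 ≤ n → 2 * m ≡ n * r →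
  (G : Graph n) → MaxTriangles m r G → MinTrianglesRegular (n ∸ r ∸ 1) (complement G)
maximum⇒complement-minimum {n} m r r+1≤n 2m≡nr G (inClass , maximal) = regH , minimal
  where
  d : ℕ
  d = n ∸ r ∸ 1
  r+d+1≡n : r + d + 1 ≡ n
  r+d+1≡n = complement-degree-sum r r+1≤n
  d+r+1≡n : d + r + 1 ≡ n
  d+r+1≡n = trans (cong (_+ 1) (+-comm d r)) r+d+1≡n
  regG : Regular G r
  regG = inClass⇒regular m r G 2m≡nr inClass
  regH : Regular (complement G) d
  regH = complement-regular G r d r+d+1≡n regG
  minimal : ∀ H′ → Regular H′ d → triangles (complement G) ≤ triangles H′
  minimal H′ regH′ = exchange
    (triangle-sum-invariant r d G (complement G) (complement H′) H′
       (isComplement-complement G) regG regH (complement-isComplement H′) regG′ regH′)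
    (maximal (complement H′) (regular⇒inClass m r (complement H′) 2m≡nr regG′))
    where
    regG′ : Regular (complement H′) r
    regG′ = complement-regular H′ d r d+r+1≡n regH′

triangle-free⇒complement-maximum : ∀ {n} m r → r + 1 ≤ n → 2 * m ≡ n * r →
  TriangleFreeRegular n (n ∸ r ∸ 1) →
  Σ (Graph n) λ G → MaxTriangles m r G × 2 * triangles G + n * r * (n ∸ 1 ∸ r) ≡ 2 * (n C 3)
triangle-free⇒complement-maximum {n} m r r+1≤n 2m≡nr (H , regH , t≡0) =
  complement H , (regular⇒inClass m r (complement H) 2m≡nr regG , maximal) , count
  where
  d : ℕ
  d = n ∸ r ∸ 1
  r+d+1≡n : r + d + 1 ≡ n
  r+d+1≡n = complement-degree-sum r r+1≤n
  regG : Regular (complement H) r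
  regG = complement-regular H d r (trans (cong (_+ 1) (+-comm d r)) r+d+1≡n) regH
  maximal : ∀ G′ → InClass m r G′ → triangles G′ ≤ triangles (complement H)
  maximal G′ inClass = begin
    triangles G′                                 ≤⟨ m≤m+n (triangles G′) _ ⟩
    triangles G′ + triangles (complement G′)     ≡⟨ sym (triangle-sum-invariant r d
        (complement H) H G′ (complement G′) (complement-isComplement H) regG regH
        (isComplement-complement G′) regG′ (complement-regular G′ r d r+d+1≡n regG′)) ⟩
    triangles (complement H) + triangles H       ≡⟨ cong (triangles (complement H) +_) t≡0 ⟩
    triangles (complement H) + 0                 ≡⟨ +-identityʳ _ ⟩
    triangles (complement H)                     ∎
    where
    open ≤-Reasoning
    regG′ : Regular G′ r
    regG′ = inClass⇒regular m r G′ 2m≡nr inClass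
  count : 2 * triangles (complement H) + n * r * (n ∸ 1 ∸ r) ≡ 2 * (n C 3)
  count = begin
    2 * triangles (complement H) + n * r * (n ∸ 1 ∸ r)
      ≡⟨ cong (λ x → 2 * triangles (complement H) + n * r * x) (∸-swap n 1 r) ⟩
    2 * triangles (complement H) + n * r * d
      ≡⟨ regroup n r d (triangles (complement H)) ⟩
    n * (r * d) + 2 * triangles (complement H) + 2 * 0
      ≡⟨ cong (λ t → n * (r * d) + 2 * triangles (complement H) + 2 * t) (sym t≡0) ⟩
    n * (r * d) + 2 * triangles (complement H) + 2 * triangles H
      ≡⟨ goodman-regular (complement H) H r d (complement-isComplement H) regG regH ⟩
    2 * (n C 3) ∎
    where
    open ≡-Reasoning
    regroup : ∀ n r d t → 2 * t + n * r * d ≡ n * (r * d) + 2 * t + 2 * 0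
    regroup = solve-∀

Sum : ℕ → (ℕ → ℕ) → ℕ
Sum zero    g = 0
Sum (suc n) g = g 0 + Sum n (g ∘ suc)

sumF-toℕ : ∀ n (g : ℕ → ℕ) → sumF {n} (g ∘ toℕ) ≡ Sum n g
sumF-toℕ zero    g = refl
sumF-toℕ (suc n) g = cong (g 0 +_) (sumF-toℕ n (g ∘ suc))

Sum-cong : ∀ n {g h : ℕ → ℕ} → (∀ x → x < n → g x ≡ h x) → Sum n g ≡ Sum n h
Sum-cong zero    e = refl
Sum-cong (suc n) e = cong₂ _+_ (e 0 (s≤s z≤n)) (Sum-cong n (λ x x<n → e (suc x) (s≤s x<n)))

Sum-split : ∀ a b (g : ℕ → ℕ) → Sum (a + b) g ≡ Sum a g + Sum b (λ x → g (a + x))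
Sum-split zero    b g = refl
Sum-split (suc a) b g = trans (cong (g 0 +_) (Sum-split a b (g ∘ suc))) (sym (+-assoc (g 0) _ _))

Sum-snoc : ∀ n (g : ℕ → ℕ) → Sum (suc n) g ≡ Sum n g + g n
Sum-snoc zero    g = +-comm (g 0) 0
Sum-snoc (suc n) g = trans (cong (g 0 +_) (Sum-snoc n (g ∘ suc))) (sym (+-assoc (g 0) _ _))

Sum-const : ∀ n c → Sum n (λ _ → c) ≡ n * c
Sum-const zero    c = refl
Sum-const (suc n) c = cong (c +_) (Sum-const n c)

Sum-zero : ∀ n → Sum n (λ _ → 0) ≡ 0
Sum-zero n = trans (Sum-const n 0) (*-zeroʳ n)

Sum-one : ∀ n → Sum n (λ _ → 1) ≡ n
Sum-one n = trans (Sum-const n 1) (*-identityʳ n)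

Sum-+ : ∀ n (g h : ℕ → ℕ) → Sum n (λ x → g x + h x) ≡ Sum n g + Sum n h
Sum-+ n g h = trans (sym (sumF-toℕ n (λ x → g x + h x)))
  (trans (sumF-+ {n} (g ∘ toℕ) (h ∘ toℕ)) (cong₂ _+_ (sumF-toℕ n g) (sumF-toℕ n h)))

Sum-reverse : ∀ n (g : ℕ → ℕ) → Sum n g ≡ Sum n (λ y → g (n ∸ suc y))
Sum-reverse zero    g = refl
Sum-reverse (suc n) g = begin
  g 0 + Sum n (g ∘ suc)                   ≡⟨ cong (g 0 +_) (Sum-reverse n (g ∘ suc)) ⟩
  g 0 + Sum n (λ y → g (suc (n ∸ suc y)))  ≡⟨ cong (g 0 +_) (Sum-cong n (λ y y<n → cong g (sym (+-∸-assoc 1 y<n)))) ⟩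
  g 0 + Sum n (λ y → g (n ∸ y))           ≡⟨ +-comm (g 0) _ ⟩
  Sum n (λ y → g (n ∸ y)) + g 0           ≡⟨ cong (λ z → Sum n (λ y → g (n ∸ y)) + g z) (sym (n∸n≡0 n)) ⟩
  Sum n (λ y → g (n ∸ y)) + g (n ∸ n)     ≡⟨ sym (Sum-snoc n (λ y → g (n ∸ y))) ⟩
  Sum (suc n) (λ y → g (n ∸ y))           ∎
  where open ≡-Reasoning

Sum-rotate : ∀ n (g : ℕ → ℕ) → g n ≡ g 0 → Sum n (g ∘ suc) ≡ Sum n g
Sum-rotate n g gn≡g0 = +-cancelˡ-≡ (g 0) _ _ (begin
  g 0 + Sum n (g ∘ suc)  ≡⟨ Sum-snoc n g ⟩
  Sum n g + g n          ≡⟨ cong (Sum n g +_) gn≡g0 ⟩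
  Sum n g + g 0          ≡⟨ +-comm (Sum n g) (g 0) ⟩
  g 0 + Sum n g          ∎)
  where open ≡-Reasoning

Sum-translate : ∀ n .{{_ : NonZero n}} (P : ℕ → ℕ) c → Sum n (λ y → P ((c + y) % n)) ≡ Sum n P
Sum-translate n P zero    = Sum-cong n (λ x x<n → cong P (m<n⇒m%n≡m x<n))
Sum-translate n P (suc c) = begin
  Sum n (λ y → P ((suc c + y) % n))   ≡⟨ Sum-cong n (λ x _ → cong (λ z → P (z % n)) (sym (+-suc c x))) ⟩
  Sum n (λ y → P ((c + suc y) % n))   ≡⟨ Sum-rotate n (λ y → P ((c + y) % n)) (cong P period) ⟩
  Sum n (λ y → P ((c + y) % n))       ≡⟨ Sum-translate n P c ⟩
  Sum n P                            ∎
  where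
  open ≡-Reasoning
  period : (c + n) % n ≡ (c + 0) % n
  period = trans ([m+n]%n≡m%n c n) (cong (_% n) (sym (+-identityʳ c)))

<ᵇ-true : ∀ {a b} → a < b → (a <ᵇ b) ≡ true
<ᵇ-true {zero}  {suc b} _         = refl
<ᵇ-true {suc a} {suc b} (s≤s a<b) = <ᵇ-true a<b

<ᵇ-false : ∀ {a b} → b ≤ a → (a <ᵇ b) ≡ false
<ᵇ-false {a}     {zero}  _         = refl
<ᵇ-false {suc a} {suc b} (s≤s b≤a) = <ᵇ-false b≤a

<ᵇ-true⇒< : ∀ a b → (a <ᵇ b) ≡ true → a < b
<ᵇ-true⇒< zero    (suc b) _ = s≤s z≤n
<ᵇ-true⇒< (suc a) (suc b) e = s≤s (<ᵇ-true⇒< a b e)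

<ᵇ-false⇒≥ : ∀ a b → (a <ᵇ b) ≡ false → b ≤ a
<ᵇ-false⇒≥ a       zero    _ = z≤n
<ᵇ-false⇒≥ (suc a) (suc b) e = s≤s (<ᵇ-false⇒≥ a b e)

count-below : ∀ h d → d ≤ h → Sum h (λ y → χ (y <ᵇ d)) ≡ d
count-below h d d≤h = begin
  Sum h (λ y → χ (y <ᵇ d))                                   ≡⟨ cong (λ z → Sum z (λ y → χ (y <ᵇ d))) (sym (m+[n∸m]≡n d≤h)) ⟩
  Sum (d + (h ∸ d)) (λ y → χ (y <ᵇ d))                       ≡⟨ Sum-split d (h ∸ d) (λ y → χ (y <ᵇ d)) ⟩
  Sum d (λ y → χ (y <ᵇ d)) + Sum (h ∸ d) (λ y → χ (d + y <ᵇ d)) ≡⟨ cong₂ _+_ below above ⟩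
  d + 0                                                       ≡⟨ +-identityʳ d ⟩
  d                                                           ∎
  where
  open ≡-Reasoning
  below : Sum d (λ y → χ (y <ᵇ d)) ≡ d
  below = trans (Sum-cong d (λ y y<d → cong χ (<ᵇ-true y<d))) (Sum-one d)
  above : Sum (h ∸ d) (λ y → χ (d + y <ᵇ d)) ≡ 0
  above = trans (Sum-cong (h ∸ d) (λ y _ → cong χ (<ᵇ-false (m≤m+n d y)))) (Sum-zero (h ∸ d))

cyclicBand : ∀ h .{{_ : NonZero h}} → ℕ → ℕ → ℕ → Bool
cyclicBand h d x y = ((x + y) % h) <ᵇ d

cyclicBand-count : ∀ h .{{_ : NonZero h}} d → d ≤ h → ∀ x → Sum h (λ y → χ (cyclicBand h d x y)) ≡ d
cyclicBand-count h d d≤h x = trans (Sum-translate h (λ z → χ (z <ᵇ d)) x) (count-below h d d≤h)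

cyclicBand-count′ : ∀ h .{{_ : NonZero h}} d → d ≤ h → ∀ x → Sum h (λ y → χ (cyclicBand h d y x)) ≡ d
cyclicBand-count′ h d d≤h x = trans
  (Sum-cong h (λ y _ → cong (λ z → χ ((z % h) <ᵇ d)) (+-comm y x)))
  (cyclicBand-count h d d≤h x)

relGraph : ∀ n (A : ℕ → ℕ → Bool) → (∀ x y → A x y ≡ A y x) → (∀ x → A x x ≡ false) → Graph n
relGraph n A sym irr = record
  { adj = λ u v → A (toℕ u) (toℕ v) ; adj-sym = λ u v → sym (toℕ u) (toℕ v) ; adj-irr = irr ∘ toℕ }

Σ3-zero : ∀ {n} (F : Fin n → Fin n → Fin n → ℕ) → (∀ i j k → F i j k ≡ 0) → Σ3 F ≡ 0
Σ3-zero {n} F F≡0 = trans (Σ3-cong F≡0)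
  (trans (sumF-cong {n} (λ i → trans (sumF-cong {n} (λ j → sumF-zero {n})) (sumF-zero {n}))) (sumF-zero {n}))

relation⇒triangleFreeRegular : ∀ n d (A : ℕ → ℕ → Bool) sym irr →
  (∀ x → x < n → Sum n (λ y → χ (A x y)) ≡ d) →
  (∀ a b c → a < b → b < c → c < n → (A a b ∧ A b c ∧ A a c) ≡ false) →
  TriangleFreeRegular n d
relation⇒triangleFreeRegular n d A sym irr deg tf = G , regular , triangle-free
  where
  G : Graph n
  G = relGraph n A sym irr
  regular : Regular G d
  regular v = trans (sumF-toℕ n (λ y → χ (A (toℕ v) y))) (deg (toℕ v) (toℕ<n v))
  no-triangle : ∀ (o₁ o₂ t : Bool) → (o₁ ≡ true → o₂ ≡ true → t ≡ false) → χ (o₁ ∧ o₂ ∧ t) ≡ 0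
  no-triangle true  true  t f rewrite f refl refl = refl
  no-triangle true  false t f = refl
  no-triangle false o₂    t f = refl
  triangle-free : triangles G ≡ 0
  triangle-free = Σ3-zero _ λ i j k → no-triangle (i <F j) (j <F k) (isTriangle G i j k)
    λ i<j j<k → tf (toℕ i) (toℕ j) (toℕ k)
                   (<ᵇ-true⇒< _ _ i<j) (<ᵇ-true⇒< _ _ j<k) (toℕ<n k)

-- Construction 1 (even order): bipartite circulants

-- On 2h vertices, join x < h to h + y iff (x + y) mod h < d.  Both sides are independent,
-- so the graph is bipartite, and it is d-regular by translation invariance.
module BipartiteCirculant (h d : ℕ) .{{_ : NonZero h}} (d≤h : d ≤ h) where

  -- the first two arguments record whether the endpoints lie on the left side
  edge : Bool → Bool → ℕ → ℕ → Bool
  edge true  false x y = cyclicBand h d x (y ∸ h)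
  edge false true  x y = cyclicBand h d y (x ∸ h)
  edge _     _     _ _ = false

  edge-sym : ∀ s t x y → edge s t x y ≡ edge t s y x
  edge-sym true  true  x y = refl
  edge-sym true  false x y = refl
  edge-sym false true  x y = refl
  edge-sym false false x y = refl

  edge-irr : ∀ s x → edge s s x x ≡ false
  edge-irr true  x = refl
  edge-irr false x = refl

  ∧-false₃ : ∀ x y → x ∧ y ∧ false ≡ false
  ∧-false₃ x y = trans (cong (x ∧_) (∧-zeroʳ y)) (∧-zeroʳ x)

  -- two of any three vertices lie on the same side
  edge-triangle-free : ∀ s t u a b c → (edge s t a b ∧ edge t u b c ∧ edge s u a c) ≡ false
  edge-triangle-free true  true  u     a b c = refl
  edge-triangle-free true  false true  a b c = ∧-false₃ (edge true false a b) (edge false true b c)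
  edge-triangle-free true  false false a b c = ∧-zeroʳ _
  edge-triangle-free false true  true  a b c = ∧-zeroʳ _
  edge-triangle-free false true  false a b c = ∧-false₃ (edge false true a b) (edge true false b c)
  edge-triangle-free false false u     a b c = refl

  A : ℕ → ℕ → Bool
  A x y = edge (x <ᵇ h) (y <ᵇ h) x y

  degree-left : ∀ x → x < h → Sum (h + h) (λ y → χ (A x y)) ≡ d
  degree-left x x<h rewrite Sum-split h h (λ y → χ (A x y)) | <ᵇ-true x<h = cong₂ _+_
    (trans (Sum-cong h (λ y y<h → cong (λ b → χ (edge true b x y)) (<ᵇ-true y<h))) (Sum-zero h))
    (trans (Sum-cong h (λ y _ → trans (cong (λ b → χ (edge true b x (h + y))) (<ᵇ-false (m≤m+n h y)))
                                      (cong (χ ∘ cyclicBand h d x) (m+n∸m≡n h y))))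
           (cyclicBand-count h d d≤h x))

  degree-right : ∀ x → h ≤ x → Sum (h + h) (λ y → χ (A x y)) ≡ d
  degree-right x h≤x rewrite Sum-split h h (λ y → χ (A x y)) | <ᵇ-false h≤x = trans (cong₂ _+_
    (trans (Sum-cong h (λ y y<h → cong (λ b → χ (edge false b x y)) (<ᵇ-true y<h)))
           (cyclicBand-count′ h d d≤h (x ∸ h)))
    (trans (Sum-cong h (λ y _ → cong (λ b → χ (edge false b x (h + y))) (<ᵇ-false (m≤m+n h y)))) (Sum-zero h)))
    (+-identityʳ d)

  all-degrees : ∀ x → x < h + h → Sum (h + h) (λ y → χ (A x y)) ≡ d
  all-degrees x _ with x <? h
  ... | yes x<h = degree-left x x<h
  ... | no  x≮h = degree-right x (≮⇒≥ x≮h)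

bipartiteCirculant : ∀ h d .{{_ : NonZero h}} → d ≤ h → TriangleFreeRegular (h + h) d
bipartiteCirculant h d d≤h = relation⇒triangleFreeRegular (h + h) d A
  (λ x y → edge-sym (x <ᵇ h) (y <ᵇ h) x y) (λ x → edge-irr (x <ᵇ h) x) all-degrees
  (λ a b c _ _ _ → edge-triangle-free (a <ᵇ h) (b <ᵇ h) (c <ᵇ h) a b c)
  where open BipartiteCirculant h d d≤h

-- Construction 2 (odd order, 6K < n): a circulant

-- On ℤ/n join x and y iff their cyclic distance lies in the window [K, 2K).  This graph
-- is 2K-regular, and for 6K < n no three cyclic distances a, b, a + b lie in the window.
module Circulant (n K : ℕ) .{{_ : NonZero n}} (6K<n : 6 * K < n) where

  inWindow : ℕ → Bool
  inWindow t = not (t <ᵇ K) ∧ (t <ᵇ K + K)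

  P : ℕ → Bool
  P t = inWindow t ∨ inWindow (n ∸ t)

  gap : ℕ → ℕ → ℕ
  gap x y = (x ∸ y) + (y ∸ x)

  A : ℕ → ℕ → Bool
  A x y = P (gap x y)

  A-sym : ∀ x y → A x y ≡ A y x
  A-sym x y = cong P (+-comm (x ∸ y) (y ∸ x))

  4K≤n : (K + K) + (K + K) ≤ n
  4K≤n = ≤-trans (≤-trans (m≤m+n _ (K + K)) (≤-reflexive (six K))) (<⇒≤ 6K<n)
    where
    six : ∀ K → (K + K) + (K + K) + (K + K) ≡ 6 * K
    six = solve-∀

  2K≤n : K + K ≤ n
  2K≤n = ≤-trans (m≤m+n (K + K) (K + K)) 4K≤n

  inWindow-0 : inWindow 0 ≡ false
  inWindow-0 = zero-outside K
    where
    zero-outside : ∀ k → not (0 <ᵇ k) ∧ (0 <ᵇ k + k) ≡ false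
    zero-outside zero    = refl
    zero-outside (suc _) = refl

  inWindow-beyond : ∀ t → K + K ≤ t → inWindow t ≡ false
  inWindow-beyond t 2K≤t = trans (cong (not (t <ᵇ K) ∧_) (<ᵇ-false 2K≤t)) (∧-zeroʳ _)

  A-irr : ∀ x → A x x ≡ false
  A-irr x rewrite n∸n≡0 x | inWindow-0 | inWindow-beyond n 2K≤n = refl

  window-count : ∀ N → K + K ≤ N → Sum N (χ ∘ inWindow) ≡ K
  window-count N 2K≤N = +-cancelˡ-≡ K _ K (begin
    K + Sum N (χ ∘ inWindow)                        ≡⟨ cong (_+ Sum N (χ ∘ inWindow)) (sym (count-below N K K≤N)) ⟩
    Sum N (λ y → χ (y <ᵇ K)) + Sum N (χ ∘ inWindow) ≡⟨ sym (Sum-+ N (λ y → χ (y <ᵇ K)) (χ ∘ inWindow)) ⟩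
    Sum N (λ y → χ (y <ᵇ K) + χ (inWindow y))       ≡⟨ Sum-cong N (λ y _ → below-or-window y) ⟩
    Sum N (λ y → χ (y <ᵇ K + K))                    ≡⟨ count-below N (K + K) 2K≤N ⟩
    K + K                                           ∎)
    where
    open ≡-Reasoning
    K≤N : K ≤ N
    K≤N = ≤-trans (m≤m+n K K) 2K≤N
    below-or-window : ∀ y → χ (y <ᵇ K) + χ (inWindow y) ≡ χ (y <ᵇ K + K)
    below-or-window y with y <ᵇ K in y<K
    ... | true  rewrite <ᵇ-true (≤-trans (<ᵇ-true⇒< y K y<K) (m≤m+n K K)) = refl
    ... | false = refl

  window-bounds : ∀ t → inWindow t ≡ true → K ≤ t × t < K + K
  window-bounds t in-t with t <ᵇ K in t<K | t <ᵇ K + K in t<2K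
  ... | false | true = <ᵇ-false⇒≥ t K t<K , <ᵇ-true⇒< t (K + K) t<2K
  ... | true  | _    with in-t
  ... | ()
  window-bounds t in-t | false | false with in-t
  ... | ()

  window-disjoint : ∀ t → t < n → inWindow t ≡ true → inWindow (n ∸ t) ≡ false
  window-disjoint t t<n in-t = inWindow-beyond (n ∸ t) (m+n≤o⇒m≤o∸n (K + K) (begin
    K + K + t              ≤⟨ +-monoʳ-≤ (K + K) (<⇒≤ t<2K) ⟩
    (K + K) + (K + K)      ≤⟨ 4K≤n ⟩
    n                      ∎))
    where
    open ≤-Reasoning
    t<2K : t < K + K
    t<2K = proj₂ (window-bounds t in-t)

  window-count-reflected : Sum n (λ t → χ (inWindow (n ∸ t))) ≡ K
  window-count-reflected = begin
    Sum n (λ t → χ (inWindow (n ∸ t)))                ≡⟨ Sum-reverse n (λ t → χ (inWindow (n ∸ t))) ⟩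
    Sum n (λ y → χ (inWindow (n ∸ (n ∸ suc y))))      ≡⟨ Sum-cong n (λ y y<n → cong (χ ∘ inWindow) (m∸[m∸n]≡n y<n)) ⟩
    Sum n (χ ∘ inWindow ∘ suc)                        ≡⟨ cong (λ b → χ b + Sum n (χ ∘ inWindow ∘ suc)) (sym inWindow-0) ⟩
    Sum (suc n) (χ ∘ inWindow)                        ≡⟨ window-count (suc n) (≤-trans 2K≤n (n≤1+n n)) ⟩
    K                                                 ∎
    where open ≡-Reasoning

  P-reflect : ∀ t → t ≤ n → P (n ∸ t) ≡ P t
  P-reflect t t≤n rewrite m∸[m∸n]≡n t≤n = ∨-comm (inWindow (n ∸ t)) (inWindow t)

  clockwise-forward : ∀ x y → x ≤ y → y < n → ((n ∸ x) + y) % n ≡ y ∸ x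
  clockwise-forward x y x≤y y<n = begin
    ((n ∸ x) + y) % n        ≡⟨ cong (_% n) (sym wrap) ⟩
    ((y ∸ x) + n) % n        ≡⟨ [m+n]%n≡m%n (y ∸ x) n ⟩
    (y ∸ x) % n              ≡⟨ m<n⇒m%n≡m (≤-<-trans (m∸n≤m y x) y<n) ⟩
    y ∸ x                    ∎
    where
    open ≡-Reasoning
    x≤n : x ≤ n
    x≤n = ≤-trans x≤y (<⇒≤ y<n)
    shuffle : ∀ a b c → a + b + c ≡ (a + c) + b
    shuffle = solve-∀
    shuffle′ : ∀ a b c → a + (b + c) ≡ b + a + c
    shuffle′ = solve-∀
    wrap : (y ∸ x) + n ≡ (n ∸ x) + y
    wrap = +-cancelʳ-≡ x _ _ (begin
      (y ∸ x) + n + x      ≡⟨ shuffle (y ∸ x) n x ⟩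
      ((y ∸ x) + x) + n    ≡⟨ cong (_+ n) (m∸n+n≡m x≤y) ⟩
      y + n                ≡⟨ cong (y +_) (sym (m∸n+n≡m x≤n)) ⟩
      y + ((n ∸ x) + x)    ≡⟨ shuffle′ y (n ∸ x) x ⟩
      (n ∸ x) + y + x      ∎)

  clockwise-backward : ∀ x y → y < x → x < n → ((n ∸ x) + y) % n ≡ n ∸ (x ∸ y)
  clockwise-backward x y y<x x<n = trans (m<n⇒m%n≡m short) (+-cancelʳ-≡ (x ∸ y) _ _ (begin
    (n ∸ x) + y + (x ∸ y)    ≡⟨ +-assoc (n ∸ x) y (x ∸ y) ⟩
    (n ∸ x) + (y + (x ∸ y))  ≡⟨ cong ((n ∸ x) +_) (m+[n∸m]≡n (<⇒≤ y<x)) ⟩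
    (n ∸ x) + x              ≡⟨ m∸n+n≡m (<⇒≤ x<n) ⟩
    n                        ≡⟨ sym (m∸n+n≡m (≤-trans (m∸n≤m x y) (<⇒≤ x<n))) ⟩
    n ∸ (x ∸ y) + (x ∸ y)    ∎))
    where
    open ≡-Reasoning
    short : (n ∸ x) + y < n
    short = <-≤-trans (+-monoʳ-< (n ∸ x) y<x) (≤-reflexive (m∸n+n≡m (<⇒≤ x<n)))

  gap-cyclic : ∀ x y → x < n → y < n → P (gap x y) ≡ P (((n ∸ x) + y) % n)
  gap-cyclic x y x<n y<n with x ≤? y
  ... | yes x≤y = cong P (begin
    (x ∸ y) + (y ∸ x)        ≡⟨ cong (_+ (y ∸ x)) (m≤n⇒m∸n≡0 x≤y) ⟩
    y ∸ x                    ≡⟨ sym (clockwise-forward x y x≤y y<n) ⟩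
    ((n ∸ x) + y) % n        ∎)
    where open ≡-Reasoning
  ... | no x≰y = begin
    P ((x ∸ y) + (y ∸ x))    ≡⟨ cong (λ z → P ((x ∸ y) + z)) (m≤n⇒m∸n≡0 (<⇒≤ y<x)) ⟩
    P ((x ∸ y) + 0)          ≡⟨ cong P (+-identityʳ (x ∸ y)) ⟩
    P (x ∸ y)                ≡⟨ sym (P-reflect (x ∸ y) (≤-trans (m∸n≤m x y) (<⇒≤ x<n))) ⟩
    P (n ∸ (x ∸ y))          ≡⟨ cong P (sym (clockwise-backward x y y<x x<n)) ⟩
    P (((n ∸ x) + y) % n)    ∎
    where
    open ≡-Reasoning
    y<x : y < x
    y<x = ≰⇒> x≰y

  all-degrees : ∀ x → x < n → Sum n (λ y → χ (A x y)) ≡ K + K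
  all-degrees x x<n = begin
    Sum n (λ y → χ (A x y))                                  ≡⟨ Sum-cong n (λ y y<n → cong χ (gap-cyclic x y x<n y<n)) ⟩
    Sum n (λ y → χ (P (((n ∸ x) + y) % n)))                  ≡⟨ Sum-translate n (χ ∘ P) (n ∸ x) ⟩
    Sum n (χ ∘ P)                                            ≡⟨ Sum-cong n (λ t t<n → χ-∨ (inWindow t) _ (window-disjoint t t<n)) ⟩
    Sum n (λ t → χ (inWindow t) + χ (inWindow (n ∸ t)))      ≡⟨ Sum-+ n (χ ∘ inWindow) (λ t → χ (inWindow (n ∸ t))) ⟩
    Sum n (χ ∘ inWindow) + Sum n (λ t → χ (inWindow (n ∸ t))) ≡⟨ cong₂ _+_ (window-count n 2K≤n) window-count-reflected ⟩
    K + K                                                    ∎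
    where
    open ≡-Reasoning
    χ-∨ : ∀ a b → (a ≡ true → b ≡ false) → χ (a ∨ b) ≡ χ a + χ b
    χ-∨ true  b f rewrite f refl = refl
    χ-∨ false b f = refl

  Admissible : ℕ → Set
  Admissible t = (K ≤ t × t < K + K) ⊎ (K + t ≤ n × n < K + K + t)

  admissible : ∀ t → t ≤ n → P t ≡ true → Admissible t
  admissible t t≤n Pt with inWindow t in in-t | inWindow (n ∸ t) in in-nt
  ... | true | _ = inj₁ (window-bounds t in-t)
  ... | false | true = inj₂ (m≤o∸n⇒m+n≤o K t≤n K≤n-t , (begin-strict
      n                    ≡⟨ sym (m∸n+n≡m t≤n) ⟩
      (n ∸ t) + t          <⟨ +-monoˡ-< t n-t<2K ⟩
      K + K + t            ∎))
    where
    open ≤-Reasoning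
    K≤n-t : K ≤ n ∸ t
    K≤n-t = proj₁ (window-bounds (n ∸ t) in-nt)
    n-t<2K : n ∸ t < K + K
    n-t<2K = proj₂ (window-bounds (n ∸ t) in-nt)
  ... | false | false with Pt
  ... | ()

  admissible-≥K : ∀ t → Admissible t → K ≤ t
  admissible-≥K t (inj₁ (K≤t , _)) = K≤t
  admissible-≥K t (inj₂ (_ , n<2K+t)) = +-cancelˡ-≤ (K + K) K t (begin
    K + K + K               ≤⟨ m≤m+n (K + K + K) (K + K + K) ⟩
    K + K + K + (K + K + K) ≡⟨ six K ⟩
    6 * K                   ≤⟨ <⇒≤ (<-trans 6K<n n<2K+t) ⟩
    K + K + t               ∎)
    where
    open ≤-Reasoning
    six : ∀ K → K + K + K + (K + K + K) ≡ 6 * K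
    six = solve-∀

  no-admissible-triangle : ∀ u v → Admissible u → Admissible v → Admissible (u + v) → ⊥
  no-admissible-triangle u v adm-u adm-v (inj₁ (_ , u+v<2K)) =
    <⇒≱ u+v<2K (+-mono-≤ (admissible-≥K u adm-u) (admissible-≥K v adm-v))
  no-admissible-triangle u v (inj₂ (_ , n<2K+u)) adm-v (inj₂ (K+u+v≤n , _)) =
    <⇒≱ (+-cancelˡ-< (K + u) v K (begin-strict
      K + u + v        ≡⟨ +-assoc K u v ⟩
      K + (u + v)      ≤⟨ K+u+v≤n ⟩
      n                <⟨ n<2K+u ⟩
      K + K + u        ≡⟨ swap K K u ⟩
      K + u + K        ∎)) (admissible-≥K v adm-v)
    where
    open ≤-Reasoning
    swap : ∀ a b c → a + b + c ≡ a + c + b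
    swap = solve-∀
  no-admissible-triangle u v adm-u@(inj₁ _) (inj₂ (_ , n<2K+v)) (inj₂ (K+u+v≤n , _)) =
    <⇒≱ (+-cancelˡ-< (K + v) u K (begin-strict
      K + v + u        ≡⟨ swap K v u ⟩
      K + (u + v)      ≤⟨ K+u+v≤n ⟩
      n                <⟨ n<2K+v ⟩
      K + K + v        ≡⟨ swap′ K K v ⟩
      K + v + K        ∎)) (admissible-≥K u adm-u)
    where
    open ≤-Reasoning
    swap : ∀ a b c → a + b + c ≡ a + (c + b)
    swap = solve-∀
    swap′ : ∀ a b c → a + b + c ≡ a + c + b
    swap′ = solve-∀
  no-admissible-triangle u v (inj₁ (_ , u<2K)) (inj₁ (_ , v<2K)) (inj₂ (_ , n<2K+u+v)) =
    <-asym 6K<n (begin-strict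
      n                        <⟨ n<2K+u+v ⟩
      K + K + (u + v)          <⟨ +-monoʳ-< (K + K) (+-mono-< u<2K v<2K) ⟩
      K + K + (K + K + (K + K)) ≡⟨ six K ⟩
      6 * K                    ∎)
    where
    open ≤-Reasoning
    six : ∀ K → K + K + (K + K + (K + K)) ≡ 6 * K
    six = solve-∀

  triangle-free : ∀ a b c → a < b → b < c → c < n → (A a b ∧ A b c ∧ A a c) ≡ false
  triangle-free a b c a<b b<c c<n = not-all-three λ ab bc ac →
    no-admissible-triangle (b ∸ a) (c ∸ b)
      (admissible (b ∸ a) (≤-trans (m∸n≤m b a) b≤n) (trans (cong P (sym (gap-ordered (<⇒≤ a<b)))) ab))
      (admissible (c ∸ b) (≤-trans (m∸n≤m c b) c≤n) (trans (cong P (sym (gap-ordered (<⇒≤ b<c)))) bc))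
      (admissible (b ∸ a + (c ∸ b)) (≤-trans (≤-reflexive chain) (≤-trans (m∸n≤m c a) c≤n))
        (trans (cong P (trans chain (sym (gap-ordered (<⇒≤ (<-trans a<b b<c)))))) ac))
    where
    c≤n : c ≤ n
    c≤n = <⇒≤ c<n
    b≤n : b ≤ n
    b≤n = <⇒≤ (<-trans b<c c<n)
    gap-ordered : ∀ {x y} → x ≤ y → gap x y ≡ y ∸ x
    gap-ordered {x} {y} x≤y = cong (_+ (y ∸ x)) (m≤n⇒m∸n≡0 x≤y)
    chain : b ∸ a + (c ∸ b) ≡ c ∸ a
    chain = +-cancelʳ-≡ a _ _ (begin
      b ∸ a + (c ∸ b) + a     ≡⟨ shuffle (b ∸ a) (c ∸ b) a ⟩
      (b ∸ a + a) + (c ∸ b)   ≡⟨ cong (_+ (c ∸ b)) (m∸n+n≡m (<⇒≤ a<b)) ⟩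
      b + (c ∸ b)             ≡⟨ m+[n∸m]≡n (<⇒≤ b<c) ⟩
      c                       ≡⟨ sym (m∸n+n≡m (<⇒≤ (<-trans a<b b<c))) ⟩
      c ∸ a + a               ∎)
      where
      open ≡-Reasoning
      shuffle : ∀ x y z → x + y + z ≡ (x + z) + y
      shuffle = solve-∀
    not-all-three : ∀ {x y z} → (x ≡ true → y ≡ true → z ≡ true → ⊥) → (x ∧ y ∧ z) ≡ false
    not-all-three {true}  {true}  {true}  f = ⊥-elim (f refl refl refl)
    not-all-three {true}  {true}  {false} f = refl
    not-all-three {true}  {false}         f = refl
    not-all-three {false}                 f = refl

circulant : ∀ n K .{{_ : NonZero n}} → 6 * K < n → TriangleFreeRegular n (K + K)
circulant n K 6K<n = relation⇒triangleFreeRegular n (K + K) A A-sym A-irr all-degrees triangle-free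
  where open Circulant n K 6K<n

-- Construction 3 (odd order, 5K ≤ n ≤ 6K): a blow-up of the 5-cycle

pattern c₀ = fzero
pattern c₁ = fsuc fzero
pattern c₂ = fsuc (fsuc fzero)
pattern c₃ = fsuc (fsuc (fsuc fzero))
pattern c₄ = fsuc (fsuc (fsuc (fsuc fzero)))

C5 : Fin 5 → Fin 5 → Bool
C5 a b = ((toℕ a + 1) % 5 ≡ᵇ toℕ b) ∨ ((toℕ b + 1) % 5 ≡ᵇ toℕ a)

C5-sym : ∀ a b → C5 a b ≡ C5 b a
C5-sym a b = ∨-comm ((toℕ a + 1) % 5 ≡ᵇ toℕ b) ((toℕ b + 1) % 5 ≡ᵇ toℕ a)

C5-irrefl : ∀ a → C5 a a ≡ false
C5-irrefl = toWitness {a? = all? λ a → C5 a a ≟ᴮ false} _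

C5-triangle-free : ∀ a b c → (C5 a b ∧ C5 b c ∧ C5 a c) ≡ false
C5-triangle-free =
  toWitness {a? = all? λ a → all? λ b → all? λ c → (C5 a b ∧ C5 b c ∧ C5 a c) ≟ᴮ false} _

blowup-triangle-free : {C : Set} (pat : C → C → Bool) →
  (∀ a b c → (pat a b ∧ pat b c ∧ pat a c) ≡ false) → (col : ℕ → C) (E : ℕ → ℕ → Bool) →
  ∀ x y z → ((pat (col x) (col y) ∧ E x y) ∧ (pat (col y) (col z) ∧ E y z) ∧ (pat (col x) (col z) ∧ E x z)) ≡ false
blowup-triangle-free pat pat-tf col E x y z =
  refine (pat (col x) (col y)) (E x y) (pat (col y) (col z)) (E y z) (pat (col x) (col z)) (E x z)
         (pat-tf (col x) (col y) (col z))
  where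
  refine : ∀ p e q f r g → (p ∧ q ∧ r) ≡ false → ((p ∧ e) ∧ (q ∧ f) ∧ (r ∧ g)) ≡ false
  refine false e q     f r     g _ = refl
  refine true  e false f r     g _ = ∧-zeroʳ e
  refine true  e true  f false g _ = trans (cong (e ∧_) (∧-zeroʳ f)) (∧-zeroʳ e)

-- Blow up c₀, c₁, c₄ to independent sets of sizes p, k, k and c₂, c₃ to independent sets of
-- size c, joined completely along the cycle except between c₂ and c₃, which are joined by a
-- cyclic band of width k.  With p + c = 2k every vertex has degree 2k.
module FiveCycleBlowUp (p k c : ℕ) .{{_ : NonZero c}} (k≤c : k ≤ c) (p+c≡2k : p + c ≡ k + k) where

  -- vertex blocks, in order: c₀ on [0, p), c₁ on [p, p+k), c₄ on [p+k, m),
  -- c₂ on [m, m+c), c₃ on [m+c, m+2c)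
  m : ℕ
  m = p + (k + k)

  N : ℕ
  N = m + (c + c)

  col : ℕ → Fin 5
  col x = if x <ᵇ p then c₀ else if x <ᵇ p + k then c₁ else if x <ᵇ m then c₄
          else if x <ᵇ m + c then c₂ else c₃

  cross : ℕ → ℕ → Bool
  cross x y = cyclicBand c k (x ∸ m) (y ∸ m ∸ c)

  oneWay : Fin 5 → Fin 5 → ℕ → ℕ → Bool
  oneWay c₂ c₃ x y = cross x y
  oneWay _  _  _ _ = true

  link : Fin 5 → Fin 5 → ℕ → ℕ → Bool
  link a b x y = oneWay a b x y ∧ oneWay b a y x

  A′ : Fin 5 → Fin 5 → ℕ → ℕ → Bool
  A′ a b x y = C5 a b ∧ link a b x y

  A : ℕ → ℕ → Bool
  A x y = A′ (col x) (col y) x y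

  A-sym : ∀ x y → A x y ≡ A y x
  A-sym x y = cong₂ _∧_ (C5-sym (col x) (col y)) (∧-comm (oneWay (col x) (col y) x y) _)

  A-irr : ∀ x → A x x ≡ false
  A-irr x = cong (_∧ link (col x) (col x) x x) (C5-irrefl (col x))

  triangle-free : ∀ a b d → a < b → b < d → d < N → (A a b ∧ A b d ∧ A a d) ≡ false
  triangle-free a b d _ _ _ = blowup-triangle-free C5 C5-triangle-free col (λ x y → link (col x) (col y) x y) a b d

  col-c₀ : ∀ t → t < p → col t ≡ c₀
  col-c₀ t t<p rewrite <ᵇ-true t<p = refl

  col-c₁ : ∀ t → t < k → col (p + t) ≡ c₁
  col-c₁ t t<k rewrite <ᵇ-false (m≤m+n p t) | <ᵇ-true (+-monoʳ-< p t<k) = refl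

  col-c₄ : ∀ t → t < k → col (p + (k + t)) ≡ c₄
  col-c₄ t t<k
    rewrite <ᵇ-false (m≤m+n p (k + t)) | <ᵇ-false (+-monoʳ-≤ p (m≤m+n k t))
          | <ᵇ-true (+-monoʳ-< p (+-monoʳ-< k t<k)) = refl

  col-c₂ : ∀ t → t < c → col (m + t) ≡ c₂
  col-c₂ t t<c
    rewrite <ᵇ-false (≤-trans (m≤m+n p (k + k)) (m≤m+n m t))
          | <ᵇ-false (≤-trans (+-monoʳ-≤ p (m≤m+n k k)) (m≤m+n m t))
          | <ᵇ-false (m≤m+n m t) | <ᵇ-true (+-monoʳ-< m t<c) = refl

  col-c₃ : ∀ t → col (m + (c + t)) ≡ c₃
  col-c₃ t
    rewrite <ᵇ-false (≤-trans (m≤m+n p (k + k)) (m≤m+n m (c + t)))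
          | <ᵇ-false (≤-trans (+-monoʳ-≤ p (m≤m+n k k)) (m≤m+n m (c + t)))
          | <ᵇ-false (m≤m+n m (c + t)) | <ᵇ-false (+-monoʳ-≤ m (m≤m+n c t)) = refl

  block : ∀ size (B : ℕ → ℕ) cb v cv → col v ≡ cv → (∀ t → t < size → col (B t) ≡ cb) →
    Sum size (λ t → χ (A v (B t))) ≡ Sum size (λ t → χ (A′ cv cb v (B t)))
  block size B cb v cv e f = Sum-cong size (λ t t<s → cong₂ (λ a b → χ (A′ a b v (B t))) e (f t t<s))

  blocks : ∀ v cv → col v ≡ cv → Sum N (λ y → χ (A v y)) ≡
      Sum p (λ t → χ (A′ cv c₀ v t)) + Sum k (λ t → χ (A′ cv c₁ v (p + t)))
    + Sum k (λ t → χ (A′ cv c₄ v (p + (k + t))))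
    + (Sum c (λ t → χ (A′ cv c₂ v (m + t))) + Sum c (λ t → χ (A′ cv c₃ v (m + (c + t)))))
  blocks v cv e = begin
    Sum N g
      ≡⟨ Sum-split m (c + c) g ⟩
    Sum m g + Sum (c + c) (λ x → g (m + x))
      ≡⟨ cong₂ _+_ (trans (Sum-split p (k + k) g) (cong (Sum p g +_) (Sum-split k k (λ x → g (p + x)))))
                   (Sum-split c c (λ x → g (m + x))) ⟩
    Sum p g + (Sum k (λ t → g (p + t)) + Sum k (λ t → g (p + (k + t))))
      + (Sum c (λ t → g (m + t)) + Sum c (λ t → g (m + (c + t))))
      ≡⟨ cong (_+ (Sum c (λ t → g (m + t)) + Sum c (λ t → g (m + (c + t)))))
              (sym (+-assoc (Sum p g) _ _)) ⟩
    Sum p g + Sum k (λ t → g (p + t)) + Sum k (λ t → g (p + (k + t)))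
      + (Sum c (λ t → g (m + t)) + Sum c (λ t → g (m + (c + t))))
      ≡⟨ cong₂ _+_ (cong₂ _+_ (cong₂ _+_ (block p (λ t → t) c₀ v cv e col-c₀)
                                          (block k (p +_) c₁ v cv e col-c₁))
                              (block k (λ t → p + (k + t)) c₄ v cv e col-c₄))
                   (cong₂ _+_ (block c (m +_) c₂ v cv e col-c₂)
                              (block c (λ t → m + (c + t)) c₃ v cv e (λ t _ → col-c₃ t))) ⟩
    _ ∎
    where
    open ≡-Reasoning
    g : ℕ → ℕ
    g y = χ (A v y)

  band-c₂ : ∀ v → Sum c (λ t → χ (A′ c₂ c₃ v (m + (c + t)))) ≡ k
  band-c₂ v = trans (Sum-cong c λ t _ → trans (cong χ (∧-identityʳ (cross v (m + (c + t)))))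
                                              (cong (χ ∘ cyclicBand c k (v ∸ m)) (offset t)))
                    (cyclicBand-count c k k≤c (v ∸ m))
    where
    offset : ∀ t → m + (c + t) ∸ m ∸ c ≡ t
    offset t = trans (cong (_∸ c) (m+n∸m≡n m (c + t))) (m+n∸m≡n c t)

  band-c₃ : ∀ v → Sum c (λ t → χ (A′ c₃ c₂ v (m + t))) ≡ k
  band-c₃ v = trans (Sum-cong c λ t _ → cong (λ z → χ (cyclicBand c k z (v ∸ m ∸ c))) (m+n∸m≡n m t))
                    (cyclicBand-count′ c k k≤c (v ∸ m ∸ c))

  add₅ : ∀ {a b d e f a′ b′ d′ e′ f′} → a ≡ a′ → b ≡ b′ → d ≡ d′ → e ≡ e′ → f ≡ f′ →
    a + b + d + (e + f) ≡ a′ + b′ + d′ + (e′ + f′)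
  add₅ refl refl refl refl refl = refl

  degree-by-colour : ∀ v cv → col v ≡ cv → Sum N (λ y → χ (A v y)) ≡ k + k
  degree-by-colour v c₀ e = trans (blocks v c₀ e)
    (trans (add₅ (Sum-zero p) (Sum-one k) (Sum-one k) (Sum-zero c) (Sum-zero c)) (arith k))
    where
    arith : ∀ k → 0 + k + k + (0 + 0) ≡ k + k
    arith = solve-∀
  degree-by-colour v c₁ e = trans (blocks v c₁ e)
    (trans (add₅ (Sum-one p) (Sum-zero k) (Sum-zero k) (Sum-one c) (Sum-zero c)) (trans (arith p c) p+c≡2k))
    where
    arith : ∀ p c → p + 0 + 0 + (c + 0) ≡ p + c
    arith = solve-∀
  degree-by-colour v c₂ e = trans (blocks v c₂ e)
    (trans (add₅ (Sum-zero p) (Sum-one k) (Sum-zero k) (Sum-zero c) (band-c₂ v)) (arith k))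
    where
    arith : ∀ k → 0 + k + 0 + (0 + k) ≡ k + k
    arith = solve-∀
  degree-by-colour v c₃ e = trans (blocks v c₃ e)
    (trans (add₅ (Sum-zero p) (Sum-zero k) (Sum-one k) (band-c₃ v) (Sum-zero c)) (arith k))
    where
    arith : ∀ k → 0 + 0 + k + (k + 0) ≡ k + k
    arith = solve-∀
  degree-by-colour v c₄ e = trans (blocks v c₄ e)
    (trans (add₅ (Sum-one p) (Sum-zero k) (Sum-zero k) (Sum-zero c) (Sum-one c)) (trans (arith p c) p+c≡2k))
    where
    arith : ∀ p c → p + 0 + 0 + (0 + c) ≡ p + c
    arith = solve-∀

  all-degrees : ∀ v → v < N → Sum N (λ y → χ (A v y)) ≡ k + k
  all-degrees v _ = degree-by-colour v (col v) refl

fiveCycleBlowUp : ∀ p k c .{{_ : NonZero c}} → k ≤ c → p + c ≡ k + k →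
  TriangleFreeRegular (p + (k + k) + (c + c)) (k + k)
fiveCycleBlowUp p k c k≤c p+c≡2k =
  relation⇒triangleFreeRegular N (k + k) A A-sym A-irr all-degrees triangle-free
  where open FiveCycleBlowUp p k c k≤c p+c≡2k

halves : ∀ n → n ≡ n % 2 + (n / 2 + n / 2)
halves n = trans (m≡m%n+[m/n]*n n 2) (cong (n % 2 +_) (double (n / 2)))
  where
  double : ∀ h → h * 2 ≡ h + h
  double = solve-∀

-- For n = 2h with r + 2 ≤ n ≤ 2r + 1 the bipartite circulant applies, as n - r - 1 ≤ h.
even-order : ∀ r n → n % 2 ≡ 0 → r + 2 ≤ n → n ≤ 2 * r + 1 → TriangleFreeRegular n (n ∸ r ∸ 1)
even-order r n even r+2≤n n≤2r+1 =
  subst (λ N → TriangleFreeRegular N (n ∸ r ∸ 1)) (sym n≡h+h) (bipartiteCirculant h (n ∸ r ∸ 1) {{h≢0}} d≤h)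
  where
  h : ℕ
  h = n / 2
  n≡h+h : n ≡ h + h
  n≡h+h = trans (halves n) (cong (_+ (h + h)) even)
  h≢0 : NonZero h
  h≢0 = ≢-nonZero λ h≡0 → <⇒≢ (≤-trans (s≤s z≤n) (≤-trans (m≤n+m 2 r) r+2≤n)) (sym (trans n≡h+h (cong (λ x → x + x) h≡0)))
  h≤r : h ≤ r
  h≤r = s≤s⁻¹ (*-cancelˡ-< 2 h (suc r) (begin-strict
    2 * h          ≡⟨ cong (h +_) (+-identityʳ h) ⟩
    h + h          ≡⟨ sym n≡h+h ⟩
    n              ≤⟨ n≤2r+1 ⟩
    2 * r + 1      <⟨ +-monoʳ-< (2 * r) (s≤s (s≤s z≤n)) ⟩
    2 * r + 2      ≡⟨ double-suc r ⟩
    2 * suc r      ∎))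
    where
    open ≤-Reasoning
    double-suc : ∀ r → 2 * r + 2 ≡ 2 * suc r
    double-suc = solve-∀
    s≤s⁻¹ : ∀ {a b} → suc a ≤ suc b → a ≤ b
    s≤s⁻¹ (s≤s a≤b) = a≤b
  d≤h : n ∸ r ∸ 1 ≤ h
  d≤h = begin
    n ∸ r ∸ 1    ≤⟨ m∸n≤m (n ∸ r) 1 ⟩
    n ∸ r        ≤⟨ ∸-monoʳ-≤ n h≤r ⟩
    n ∸ h        ≡⟨ cong (_∸ h) n≡h+h ⟩
    h + h ∸ h    ≡⟨ m+n∸n≡m h h ⟩
    h            ∎
    where open ≤-Reasoning

-- For odd n, 2m = nr forces r to be even, hence n - r - 1 = 2K for some K.
odd-order-shape : ∀ r n m → n % 2 ≡ 1 → 2 * m ≡ n * r → r + 2 ≤ n → Σ ℕ λ K → n ≡ r + 1 + (K + K)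
odd-order-shape r n m odd 2m≡nr r+2≤n = h ∸ s , n-shape
  where
  h : ℕ
  h = n / 2
  n≡2h+1 : n ≡ suc (h + h)
  n≡2h+1 = trans (halves n) (cong (_+ (h + h)) odd)
  s : ℕ
  s = m ∸ h * r
  -- r = 2m - 2hr
  r≡s+s : r ≡ s + s
  r≡s+s = begin
    r                          ≡⟨ sym (m+n∸n≡m r (2 * (h * r))) ⟩
    r + 2 * (h * r) ∸ 2 * (h * r) ≡⟨ cong (_∸ 2 * (h * r)) (trans (expand h r) (trans (cong (_* r) (sym n≡2h+1)) (sym 2m≡nr))) ⟩
    2 * m ∸ 2 * (h * r)        ≡⟨ sym (*-distribˡ-∸ 2 m (h * r)) ⟩
    2 * s                      ≡⟨ cong (s +_) (+-identityʳ s) ⟩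
    s + s                      ∎
    where
    open ≡-Reasoning
    expand : ∀ h r → r + 2 * (h * r) ≡ suc (h + h) * r
    expand = solve-∀
  s≤h : s ≤ h
  s≤h = ≤-pred (*-cancelˡ-< 2 s (suc h) (begin-strict
    2 * s          ≡⟨ cong (s +_) (+-identityʳ s) ⟩
    s + s          ≡⟨ sym r≡s+s ⟩
    r              <⟨ m<m+n r (s≤s z≤n) ⟩
    r + 1          <⟨ +-monoʳ-< r (s≤s (s≤s z≤n)) ⟩
    r + 2          ≤⟨ r+2≤n ⟩
    n              ≡⟨ n≡2h+1 ⟩
    suc (h + h)    <⟨ n<1+n (suc (h + h)) ⟩
    2 + (h + h)    ≡⟨ double-suc h ⟩
    2 * suc h      ∎))
    where
    open ≤-Reasoning
    double-suc : ∀ h → 2 + (h + h) ≡ 2 * suc h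
    double-suc = solve-∀
  n-shape : n ≡ r + 1 + ((h ∸ s) + (h ∸ s))
  n-shape = begin
    n                                  ≡⟨ n≡2h+1 ⟩
    suc (h + h)                        ≡⟨ cong (λ x → suc (x + x)) (sym (m+[n∸m]≡n s≤h)) ⟩
    suc (s + (h ∸ s) + (s + (h ∸ s)))  ≡⟨ regroup s (h ∸ s) ⟩
    s + s + 1 + ((h ∸ s) + (h ∸ s))    ≡⟨ cong (λ x → x + 1 + ((h ∸ s) + (h ∸ s))) (sym r≡s+s) ⟩
    r + 1 + ((h ∸ s) + (h ∸ s))        ∎
    where
    open ≡-Reasoning
    regroup : ∀ s t → suc (s + t + (s + t)) ≡ s + s + 1 + (t + t)
    regroup = solve-∀

-- For n = r + 1 + 2K, the hypothesis n ≤ r + 1 + 2⌊r/3⌋ says K ≤ ⌊r/3⌋, so 5K < n.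
five-K<n : ∀ r n K → n ≡ r + 1 + (K + K) → n ≤ r + 1 + 2 * (r / 3) → K + (K + K + K + K) < n
five-K<n r n K n≡r+1+2K bound = begin-strict
  K + (K + K + K + K)  ≡⟨ five K ⟩
  K * 3 + (K + K)      <⟨ +-monoˡ-< (K + K) (s≤s 3K≤r) ⟩
  suc r + (K + K)      ≡⟨ cong (_+ (K + K)) (+-comm r 1) ⟨
  r + 1 + (K + K)      ≡⟨ n≡r+1+2K ⟨
  n                    ∎
  where
  open ≤-Reasoning
  five : ∀ K → K + (K + K + K + K) ≡ K * 3 + (K + K)
  five = solve-∀
  K≤r/3 : K ≤ r / 3
  K≤r/3 = *-cancelˡ-≤ 2 (+-cancelˡ-≤ (r + 1) (2 * K) (2 * (r / 3))
    (≤-trans (≤-reflexive (trans (cong (r + 1 +_) (cong (K +_) (+-identityʳ K))) (sym n≡r+1+2K))) bound))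
  3K≤r : K * 3 ≤ r
  3K≤r = ≤-trans (*-monoˡ-≤ 3 K≤r/3) (m/n*n≤m r 3)

blowup-parameters : ∀ n K → K + K + K + K ≤ n → n ≤ 6 * K →
  let p = 6 * K ∸ n ; c = n ∸ (K + K + K + K) in p + c ≡ K + K × p + (K + K) + (c + c) ≡ n
blowup-parameters n K F≤n n≤6K = p+c≡2K , order
  where
  open ≡-Reasoning
  F c p : ℕ
  F = K + K + K + K
  c = n ∸ F
  p = 6 * K ∸ n
  F+c≡n : F + c ≡ n
  F+c≡n = m+[n∸m]≡n F≤n
  p+c≡2K : p + c ≡ K + K
  p+c≡2K = +-cancelˡ-≡ F _ _ (begin
    F + (p + c)        ≡⟨ shuffle F p c ⟩
    (F + c) + p        ≡⟨ cong (_+ p) F+c≡n ⟩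
    n + p              ≡⟨ m+[n∸m]≡n n≤6K ⟩
    6 * K              ≡⟨ six K ⟩
    F + (K + K)        ∎)
    where
    shuffle : ∀ f p c → f + (p + c) ≡ f + c + p
    shuffle = solve-∀
    six : ∀ K → 6 * K ≡ K + K + K + K + (K + K)
    six = solve-∀
  order : p + (K + K) + (c + c) ≡ n
  order = begin
    p + (K + K) + (c + c)  ≡⟨ shuffle p K c ⟩
    (p + c) + (K + K) + c  ≡⟨ cong (λ x → x + (K + K) + c) p+c≡2K ⟩
    K + K + (K + K) + c    ≡⟨ four K c ⟩
    F + c                  ≡⟨ F+c≡n ⟩
    n                      ∎
    where
    shuffle : ∀ p K c → p + (K + K) + (c + c) ≡ p + c + (K + K) + c
    shuffle = solve-∀
    four : ∀ K c → K + K + (K + K) + c ≡ K + K + K + K + c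
    four = solve-∀

odd-order : ∀ r n K .{{_ : NonZero n}} → n ≡ r + 1 + (K + K) → n ≤ r + 1 + 2 * (r / 3) →
  TriangleFreeRegular n (n ∸ r ∸ 1)
odd-order r n K n≡r+1+2K bound = subst (TriangleFreeRegular n) (sym d≡2K) construction
  where
  d≡2K : n ∸ r ∸ 1 ≡ K + K
  d≡2K = trans (∸-+-assoc n r 1) (trans (cong (_∸ (r + 1)) n≡r+1+2K) (m+n∸m≡n (r + 1) (K + K)))
  5K<n : K + (K + K + K + K) < n
  5K<n = five-K<n r n K n≡r+1+2K bound
  construction : TriangleFreeRegular n (K + K)
  construction with 6 * K <? n
  ... | yes 6K<n = circulant n K 6K<n
  ... | no  6K≮n = subst (λ N → TriangleFreeRegular N (K + K)) (proj₂ parameters)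
                         (fiveCycleBlowUp (6 * K ∸ n) K c {{>-nonZero 0<c}} (<⇒≤ K<c) (proj₁ parameters))
    where
    c : ℕ
    c = n ∸ (K + K + K + K)
    K<c : K < c
    K<c = m+n≤o⇒m≤o∸n (suc K) 5K<n
    0<c : 0 < c
    0<c = ≤-<-trans z≤n K<c
    parameters : (6 * K ∸ n) + c ≡ K + K × (6 * K ∸ n) + (K + K) + (c + c) ≡ n
    parameters = blowup-parameters n K (m+n≤o⇒n≤o K (<⇒≤ 5K<n)) (≮⇒≥ 6K≮n)

triangle-free-complement-exists : ∀ r n m → 1 ≤ n → r + 2 ≤ n → n ≤ 2 * r + 1 → 2 * m ≡ n * r →
  (n % 2 ≡ 0 ⊎ (n % 2 ≡ 1 × n ≤ r + 1 + 2 * (r / 3))) → TriangleFreeRegular n (n ∸ r ∸ 1)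
triangle-free-complement-exists r n m _ r+2≤n n≤2r+1 _ (inj₁ even) = even-order r n even r+2≤n n≤2r+1
triangle-free-complement-exists r n m 1≤n r+2≤n _ 2m≡nr (inj₂ (odd , bound))
  with odd-order-shape r n m odd 2m≡nr r+2≤n
... | K , n≡r+1+2K = odd-order r n K {{>-nonZero 1≤n}} n≡r+1+2K bound


theorem14 : (r n m : ℕ) → 1 ≤ r → 1 ≤ n → r + 2 ≤ n → n ≤ 2 * r + 1 → 2 * m ≡ n * r →
    ((G : Graph n) → MaxTriangles m r G →
      Σ (Graph n) λ H → IsComplementOf G H × MinTrianglesRegular (n ∸ r ∸ 1) H)
    × ((n % 2 ≡ 0 ⊎ (n % 2 ≡ 1 × n ≤ r + 1 + 2 * (r / 3))) →
      Σ (Graph n) λ G → MaxTriangles m r G × 2 * triangles G + n * r * (n ∸ 1 ∸ r) ≡ 2 * (n C 3))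
theorem14 r n m _ 1≤n r+2≤n n≤2r+1 2m≡nr =
    (λ G maximiser → complement G , isComplement-complement G
                   , maximum⇒complement-minimum m r r+1≤n 2m≡nr G maximiser)
  , (λ parity → triangle-free⇒complement-maximum m r r+1≤n 2m≡nr
                  (triangle-free-complement-exists r n m 1≤n r+2≤n n≤2r+1 2m≡nr parity))
  where
  r+1≤n : r + 1 ≤ n
  r+1≤n = ≤-trans (+-monoʳ-≤ r (s≤s z≤n)) r+2≤n
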